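{- Let $q$ be a prime power such that $3$ is not a square in $\mathbb{F}_q$. Then the set $$\{(1,t,t^2,t^3,t^4)\mid t\in \mathbb{F}_q\} \cup \{(0,1,2t,3t^2,4t^3) \mid t\in \mathbb{F}_q\} \cup \{(0,0,0,0,1)\}\subseteq \mathbb{P}^4(\mathbb{F}_q)$$ is a track of size $2q+1$.
   Context: Points of $\mathbb{P}^4(\mathbb{F}_q)$ are written in homogeneous coordinates $(x_0,x_1,x_2,x_3,x_4)$. A track in $\mathbb{P}^4(\mathbb{F}_q)$ is a set of points no four distinct of which lie on a common plane (a $2$-dimensional projective subspace). -}

module Defs where

open import Level using (Level; _⊔_)
open import Algebra.Bundles using (CommutativeRing)
open import Data.Nat using (ℕ; _^_)
open import Data.Nat.Primality using (Prime)
open import Data.Fin using (Fin; zero; suc)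
open import Data.Product using (Σ; ∃; _×_; _,_)
open import Data.Sum using (_⊎_)
open import Relation.Nullary using (¬_)
open import Relation.Binary.PropositionalEquality using (_≡_)

IsPrimePower : ℕ → Set
IsPrimePower q = Σ ℕ λ p → Σ ℕ λ k → Prime p × q ≡ p ^ Data.Nat.suc k

module _ {c ℓ : Level} (R : CommutativeRing c ℓ) where
  open CommutativeRing R

  IsField : Set (c ⊔ ℓ)
  IsField = (¬ (0# ≈ 1#)) × (∀ x → ¬ (x ≈ 0#) → Σ Carrier λ y → x * y ≈ 1#)

  HasOrder : ℕ → Set (c ⊔ ℓ)
  HasOrder q = Σ (Fin q → Carrier) λ e →
                 (∀ i j → e i ≈ e j → i ≡ j) × (∀ x → Σ (Fin q) λ i → e i ≈ x)

  IsSquare : Carrier → Set (c ⊔ ℓ)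
  IsSquare x = Σ Carrier λ y → y * y ≈ x

  2# 3# 4# : Carrier
  2# = 1# + 1#
  3# = 2# + 1#
  4# = 3# + 1#

  -- homogeneous coordinate vectors of P⁴
  V5 : Set c
  V5 = Fin 5 → Carrier

  vec : Carrier → Carrier → Carrier → Carrier → Carrier → V5
  vec a b c' d e zero = a
  vec a b c' d e (suc zero) = b
  vec a b c' d e (suc (suc zero)) = c'
  vec a b c' d e (suc (suc (suc zero))) = d
  vec a b c' d e (suc (suc (suc (suc zero)))) = e

  Zero : V5 → Set ℓ
  Zero v = ∀ i → v i ≈ 0#

  NonZero : V5 → Set ℓ
  NonZero v = ¬ Zero v

  SamePoint : V5 → V5 → Set (c ⊔ ℓ)
  SamePoint v w = Σ Carrier λ a → (¬ (a ≈ 0#)) × (∀ i → w i ≈ a * v i)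

  lin3 : Carrier → V5 → Carrier → V5 → Carrier → V5 → V5
  lin3 a u b v c' w i = a * u i + b * v i + c' * w i

  LinIndep3 : V5 → V5 → V5 → Set (c ⊔ ℓ)
  LinIndep3 u v w = ∀ a b c' → Zero (lin3 a u b v c' w) → (a ≈ 0#) × (b ≈ 0#) × (c' ≈ 0#)

  InSpan3 : V5 → V5 → V5 → V5 → Set (c ⊔ ℓ)
  InSpan3 u v w x = Σ Carrier λ a → Σ Carrier λ b → Σ Carrier λ c' → ∀ i → x i ≈ lin3 a u b v c' w i

  -- a plane of P⁴ is the projectivisation of a 3-dimensional linear subspace,
  -- i.e. the span of three linearly independent vectors u v w.
  -- Points p₁ … p₄ lie on a common plane:
  OnCommonPlane : V5 → V5 → V5 → V5 → Set (c ⊔ ℓ)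
  OnCommonPlane p₁ p₂ p₃ p₄ = Σ V5 λ u → Σ V5 λ v → Σ V5 λ w →
    LinIndep3 u v w × InSpan3 u v w p₁ × InSpan3 u v w p₂ × InSpan3 u v w p₃ × InSpan3 u v w p₄

  -- a set of points of P⁴, given by a predicate on representatives
  -- (assumed invariant under rescaling, as for the set S below)
  -- is a track: no four distinct points lie on a common plane
  IsTrack : (V5 → Set (c ⊔ ℓ)) → Set (c ⊔ ℓ)
  IsTrack P = ∀ p₁ p₂ p₃ p₄ → NonZero p₁ → NonZero p₂ → NonZero p₃ → NonZero p₄ →
    P p₁ → P p₂ → P p₃ → P p₄ →
    ¬ SamePoint p₁ p₂ → ¬ SamePoint p₁ p₃ → ¬ SamePoint p₁ p₄ →
    ¬ SamePoint p₂ p₃ → ¬ SamePoint p₂ p₄ → ¬ SamePoint p₃ p₄ →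
    ¬ OnCommonPlane p₁ p₂ p₃ p₄

  HasSize : (V5 → Set (c ⊔ ℓ)) → ℕ → Set (c ⊔ ℓ)
  HasSize P n = Σ (Fin n → V5) λ e →
      (∀ i → NonZero (e i) × P (e i))
    × (∀ i j → SamePoint (e i) (e j) → i ≡ j)
    × (∀ v → NonZero v → P v → Σ (Fin n) λ i → SamePoint (e i) v)

  curvePt tangentPt : Carrier → V5
  curvePt t = vec 1# t (t * t) (t * t * t) (t * t * t * t)
  tangentPt t = vec 0# 1# (2# * t) (3# * (t * t)) (4# * (t * t * t))

  infPt : V5
  infPt = vec 0# 0# 0# 0# 1#

  InS : V5 → Set (c ⊔ ℓ)
  InS v = (Σ Carrier λ t → SamePoint (curvePt t) v)
        ⊎ (Σ Carrier λ t → SamePoint (tangentPt t) v)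
        ⊎ SamePoint infPt v

module Submission where

-- Read h ∈ F⁵ as the polynomial h₀ + h₁x + ⋯ + h₄x⁴. Pairing h with the curve point (1, t, …, t⁴) gives
-- h(t), with the tangent point (0, 1, 2t, 3t², 4t³) gives h′(t), and with (0, 0, 0, 0, 1) gives h₄.
-- Hence four distinct points of S are linearly independent as soon as they can be peeled off one at a
-- time, each time with a polynomial of degree ≤ 4 that has a root, a critical point, or degree < 4 at
-- the remaining points, as appropriate, but not at the peeled one. Such polynomials are written down
-- configuration by configuration; only for two curve points and two tangent points can both
-- candidates fail, and that would make 3 a square in F. Four independent vectors do not fit in a
-- 3-dimensional subspace, so S is a track. Its 2q + 1 points are the q curve points, the
-- q tangent points and the point at infinity, which are pairwise non-proportional because 2 ≠ 0.

open import Level using (Level; _⊔_; 0ℓ)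
open import Algebra.Bundles using (CommutativeRing)
open import Algebra.Bundles.Raw using (RawRing)
open import Data.Empty using (⊥; ⊥-elim)
open import Data.Empty.Polymorphic using () renaming (⊥ to ⊥ₚ)
open import Data.Fin.Base using (Fin; suc)
open import Data.Fin.Patterns using (0F; 1F; 2F; 3F; 4F)
open import Data.Integer.Base as ℤ using (ℤ; +_; -[1+_]; _⊖_; _◃_; sign; ∣_∣)
import Data.Integer.Properties as ℤ
open import Data.Maybe.Base using (Maybe; just; nothing)
open import Data.Nat.Base as ℕ using (ℕ; zero; suc)
import Data.Nat.Properties as ℕ
open import Data.Product.Base using (Σ; _×_; _,_; proj₁; proj₂)
open import Data.Sign.Base as Sign using (Sign)
open import Data.Sum.Base using (_⊎_; inj₁; inj₂)
open import Data.Unit.Polymorphic using () renaming (⊤ to ⊤ₚ)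
open import Data.Vec.Base using (Vec; []; _∷_; lookup)
open import Data.Vec.Functional using (Vector; foldr)
open import Data.Vec.Relation.Unary.All using (All; []; _∷_)
open import Relation.Binary.PropositionalEquality.Core as ≡ using (_≡_)
open import Relation.Nullary.Decidable.Core using (Dec; yes; no)
open import Relation.Nullary.Negation.Core using (¬_)

-- Every expression the ring solver has to reason about is written once, over an arbitrary raw ring:
-- instantiated at F it is the object of study, instantiated at the solver's syntax it is the term the
-- solver normalises.
module Formulas {a ℓ} (R : RawRing a ℓ) where
  open RawRing R public using (Carrier; _+_; _*_; -_; 0#; 1#)

  infixl 6 _-_
  _-_ : Carrier → Carrier → Carrier
  x - y = x + - y

  2# 3# 4# : Carrier
  2# = 1# + 1#
  3# = 2# + 1#
  4# = 3# + 1#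

  vec₃ : Carrier → Carrier → Carrier → Vector Carrier 3
  vec₃ x₀ x₁ x₂ 0F = x₀
  vec₃ x₀ x₁ x₂ 1F = x₁
  vec₃ x₀ x₁ x₂ 2F = x₂

  vec₄ : Carrier → Carrier → Carrier → Carrier → Vector Carrier 4
  vec₄ x₀ x₁ x₂ x₃ 0F = x₀
  vec₄ x₀ x₁ x₂ x₃ 1F = x₁
  vec₄ x₀ x₁ x₂ x₃ 2F = x₂
  vec₄ x₀ x₁ x₂ x₃ 3F = x₃

  vec₅ : Carrier → Carrier → Carrier → Carrier → Carrier → Vector Carrier 5
  vec₅ x₀ x₁ x₂ x₃ x₄ 0F = x₀
  vec₅ x₀ x₁ x₂ x₃ x₄ 1F = x₁
  vec₅ x₀ x₁ x₂ x₃ x₄ 2F = x₂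
  vec₅ x₀ x₁ x₂ x₃ x₄ 3F = x₃
  vec₅ x₀ x₁ x₂ x₃ x₄ 4F = x₄

  ⟪_,_⟫ : ∀ {n} → Vector Carrier n → Vector Carrier n → Carrier
  ⟪ h , v ⟫ = foldr _+_ 0# (λ i → h i * v i)

  curve tangent : Carrier → Vector Carrier 5
  curve t = vec₅ 1# t (t * t) (t * t * t) (t * t * t * t)
  tangent t = vec₅ 0# 1# (2# * t) (3# * (t * t)) (4# * (t * t * t))

  infinity : Vector Carrier 5
  infinity = vec₅ 0# 0# 0# 0# 1#

  [1] [x] [x⁴] : Vector Carrier 5
  [1] = vec₅ 1# 0# 0# 0# 0#
  [x] = vec₅ 0# 1# 0# 0# 0#
  [x⁴] = vec₅ 0# 0# 0# 0# 1#

  [x-_] : Carrier → Vector Carrier 5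
  [x- a ] = vec₅ (- a) 1# 0# 0# 0#

  -- Product of polynomials, truncated at degree 4.
  infixl 7 _·_
  _·_ : Vector Carrier 5 → Vector Carrier 5 → Vector Carrier 5
  p · q = vec₅ (p 0F * q 0F)
               (p 0F * q 1F + p 1F * q 0F)
               (p 0F * q 2F + p 1F * q 1F + p 2F * q 0F)
               (p 0F * q 3F + p 1F * q 2F + p 2F * q 1F + p 3F * q 0F)
               (p 0F * q 4F + p 1F * q 3F + p 2F * q 2F + p 3F * q 1F + p 4F * q 0F)

  infixr 8 _⋆_
  _⋆_ : Carrier → Vector Carrier 5 → Vector Carrier 5
  (c ⋆ p) i = c * p i

  infixl 6 _-valueAt_
  _-valueAt_ : Vector Carrier 5 → Carrier → Vector Carrier 5
  (p -valueAt a) 0F = p 0F - ⟪ p , curve a ⟫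
  (p -valueAt a) (suc i) = p (suc i)

  -- Antiderivatives of 12(x - b)(x - c) and of 12(x - b)(x - c)(x - d).
  criticalCubic : Carrier → Carrier → Vector Carrier 5
  criticalCubic b c = vec₅ 0# (4# * 3# * (b * c)) (- (3# * 2# * (b + c))) 4# 0#

  criticalQuartic : Carrier → Carrier → Carrier → Vector Carrier 5
  criticalQuartic b c d =
    vec₅ 0# (- (4# * 3# * (b * c * d))) (3# * 2# * (b * c + b * d + c * d)) (- (4# * (b + c + d))) 3#

  -- (x - a₂)(x - a₃)(π + σ(x - b)): its derivative vanishes at b and its value there is π².
  throughTangent : Carrier → Carrier → Carrier → Vector Carrier 5
  throughTangent b a₂ a₃ = [x- a₂ ] · [x- a₃ ] · vec₅ (π - σ * b) σ 0# 0# 0#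
    where
    π σ : Carrier
    π = (a₂ - b) * (a₃ - b)
    σ = (a₂ - b) + (a₃ - b)

  squaredQuadratic : Carrier → Carrier → Vector Carrier 5
  squaredQuadratic b₁ b₂ = (4# * 2#) ⋆ ([x- b₁ ] · [x- b₂ ] · ([x- b₁ ] · [x- b₂ ]))

  centred : Carrier → Carrier → Carrier → Carrier
  centred b₁ b₂ t = 2# * t - b₁ - b₂

  form₃ form₂ : Carrier → Carrier → Carrier → Carrier
  form₃ u₁ u₂ d = u₁ * u₁ + u₁ * u₂ + u₂ * u₂ - 3# * (d * d)
  form₂ u₁ u₂ d = u₁ * u₁ + u₂ * u₂ - 2# * (d * d)

  infixr 7 _×₃_
  _×₃_ : Vector Carrier 3 → Vector Carrier 3 → Vector Carrier 3
  x ×₃ y = vec₃ (x 1F * y 2F - x 2F * y 1F) (x 2F * y 0F - x 0F * y 2F) (x 0F * y 1F - x 1F * y 0F)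

  det₃ : Vector Carrier 3 → Vector Carrier 3 → Vector Carrier 3 → Carrier
  det₃ x y z = ⟪ x , y ×₃ z ⟫

  basis₃ : Fin 3 → Vector Carrier 3
  basis₃ 0F = vec₃ 1# 0# 0#
  basis₃ 1F = vec₃ 0# 1# 0#
  basis₃ 2F = vec₃ 0# 0# 1#

  cofactors : Vector (Vector Carrier 3) 4 → Vector Carrier 4
  cofactors x = vec₄ (det₃ (x 1F) (x 2F) (x 3F)) (- det₃ (x 0F) (x 2F) (x 3F))
                     (det₃ (x 0F) (x 1F) (x 3F)) (- det₃ (x 0F) (x 1F) (x 2F))

  adjugateColumn : Vector Carrier 3 → Vector (Vector Carrier 3) 4 → Vector Carrier 4
  adjugateColumn e x = vec₄ ⟪ e , x 1F ×₃ x 2F ⟫ ⟪ e , x 2F ×₃ x 0F ⟫ ⟪ e , x 0F ×₃ x 1F ⟫ 0#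

  exchange : Vector Carrier 3 → Vector (Vector Carrier 3) 4 → Vector Carrier 4
  exchange e x = vec₄ (- ⟪ e , x 1F ⟫) ⟪ e , x 0F ⟫ 0# 0#

module IntegerCoefficients {c ℓ} (R : CommutativeRing c ℓ) where
  open CommutativeRing R
  open import Algebra.Properties.Monoid.Mult.TCOptimised +-monoid using (1+×; ×-homo-+) renaming (_×_ to _×′_)
  open import Algebra.Properties.Semiring.Mult.TCOptimised semiring using (×1-homo-*)
  open import Algebra.Properties.AbelianGroup +-abelianGroup using (⁻¹-∙-comm)
  open import Algebra.Properties.Ring ring using (-‿distribˡ-*; -‿distribʳ-*; -‿involutive; -0#≈0#)
  open import Algebra.Solver.Ring.AlmostCommutativeRing using (fromCommutativeRing; _-Raw-AlmostCommutative⟶_)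
  open import Relation.Binary.Reasoning.Setoid setoid

  -- The optimised _×′_ sends 2 to 1# + 1#, 3 to (1# + 1#) + 1#, …, so the solver's constants agree
  -- definitionally with the numerals of Defs.
  ⟦_⟧ℤ : ℤ → Carrier
  ⟦ + n      ⟧ℤ = n ×′ 1#
  ⟦ -[1+ n ] ⟧ℤ = - (suc n ×′ 1#)

  private
    signed : Sign → Carrier → Carrier
    signed Sign.+ x = x
    signed Sign.- x = - x

    signed-cong : ∀ s {x y} → x ≈ y → signed s x ≈ signed s y
    signed-cong Sign.+ x≈y = x≈y
    signed-cong Sign.- = -‿cong

    signed-* : ∀ s t x y → signed (s Sign.* t) (x * y) ≈ signed s x * signed t y
    signed-* Sign.+ Sign.+ x y = refl
    signed-* Sign.+ Sign.- x y = -‿distribʳ-* x y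
    signed-* Sign.- Sign.+ x y = -‿distribˡ-* x y
    signed-* Sign.- Sign.- x y = begin
      x * y         ≈⟨ -‿involutive (x * y) ⟨
      - - (x * y)   ≈⟨ -‿cong (-‿distribʳ-* x y) ⟩
      - (x * - y)   ≈⟨ -‿distribˡ-* x (- y) ⟩
      - x * - y     ∎

    ⟦◃⟧ : ∀ s n → ⟦ s ◃ n ⟧ℤ ≈ signed s (n ×′ 1#)
    ⟦◃⟧ Sign.+ zero    = refl
    ⟦◃⟧ Sign.- zero    = sym -0#≈0#
    ⟦◃⟧ Sign.+ (suc n) = refl
    ⟦◃⟧ Sign.- (suc n) = refl

    ⟦sign◃∣∣⟧ : ∀ i → ⟦ i ⟧ℤ ≈ signed (sign i) (∣ i ∣ ×′ 1#)
    ⟦sign◃∣∣⟧ (+ n)      = refl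
    ⟦sign◃∣∣⟧ -[1+ n ]   = refl

    1+a-[1+b]≈a-b : ∀ a b → (1# + a) - (1# + b) ≈ a - b
    1+a-[1+b]≈a-b a b = begin
      (1# + a) + - (1# + b)        ≈⟨ +-congˡ (⁻¹-∙-comm 1# b) ⟨
      (1# + a) + (- 1# + - b)      ≈⟨ +-assoc 1# a _ ⟩
      1# + (a + (- 1# + - b))      ≈⟨ +-congˡ (+-assoc a (- 1#) (- b)) ⟨
      1# + ((a + - 1#) + - b)      ≈⟨ +-congˡ (+-congʳ (+-comm a (- 1#))) ⟩
      1# + ((- 1# + a) + - b)      ≈⟨ +-congˡ (+-assoc (- 1#) a (- b)) ⟩
      1# + (- 1# + (a + - b))      ≈⟨ +-assoc 1# (- 1#) _ ⟨
      (1# + - 1#) + (a + - b)      ≈⟨ +-congʳ (-‿inverseʳ 1#) ⟩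
      0# + (a - b)                 ≈⟨ +-identityˡ _ ⟩
      a - b                        ∎

    ⟦⊖⟧ : ∀ m n → ⟦ m ⊖ n ⟧ℤ ≈ m ×′ 1# - n ×′ 1#
    ⟦⊖⟧ zero    zero    = sym (-‿inverseʳ 0#)
    ⟦⊖⟧ zero    (suc n) = sym (+-identityˡ _)
    ⟦⊖⟧ (suc m) zero    = sym (trans (+-congˡ -0#≈0#) (+-identityʳ _))
    ⟦⊖⟧ (suc m) (suc n) = begin
      ⟦ suc m ⊖ suc n ⟧ℤ               ≡⟨ ≡.cong ⟦_⟧ℤ (ℤ.[1+m]⊖[1+n]≡m⊖n m n) ⟩
      ⟦ m ⊖ n ⟧ℤ                       ≈⟨ ⟦⊖⟧ m n ⟩
      m ×′ 1# - n ×′ 1#                  ≈⟨ 1+a-[1+b]≈a-b _ _ ⟨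
      (1# + m ×′ 1#) - (1# + n ×′ 1#)    ≈⟨ +-cong (1+× m 1#) (-‿cong (1+× n 1#)) ⟨
      suc m ×′ 1# - suc n ×′ 1#          ∎

  +-homo : ∀ i j → ⟦ i ℤ.+ j ⟧ℤ ≈ ⟦ i ⟧ℤ + ⟦ j ⟧ℤ
  +-homo (+ m)      (+ n)      = ×-homo-+ 1# m n
  +-homo (+ m)      -[1+ n ]   = ⟦⊖⟧ m (suc n)
  +-homo -[1+ m ]   (+ n)      = trans (⟦⊖⟧ n (suc m)) (+-comm _ _)
  +-homo -[1+ m ]   -[1+ n ]   = begin
    - (suc (suc (m ℕ.+ n)) ×′ 1#)      ≡⟨ ≡.cong (λ k → - (k ×′ 1#)) (ℕ.+-suc (suc m) n) ⟨
    - ((suc m ℕ.+ suc n) ×′ 1#)        ≈⟨ -‿cong (×-homo-+ 1# (suc m) (suc n)) ⟩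
    - (suc m ×′ 1# + suc n ×′ 1#)       ≈⟨ ⁻¹-∙-comm _ _ ⟨
    - (suc m ×′ 1#) + - (suc n ×′ 1#)   ∎

  *-homo : ∀ i j → ⟦ i ℤ.* j ⟧ℤ ≈ ⟦ i ⟧ℤ * ⟦ j ⟧ℤ
  *-homo i j = begin
    ⟦ s ◃ (∣ i ∣ ℕ.* ∣ j ∣) ⟧ℤ                                   ≈⟨ ⟦◃⟧ s (∣ i ∣ ℕ.* ∣ j ∣) ⟩
    signed s ((∣ i ∣ ℕ.* ∣ j ∣) ×′ 1#)                             ≈⟨ signed-cong s (×1-homo-* ∣ i ∣ ∣ j ∣) ⟩
    signed s (∣ i ∣ ×′ 1# * ∣ j ∣ ×′ 1#)                             ≈⟨ signed-* (sign i) (sign j) _ _ ⟩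
    signed (sign i) (∣ i ∣ ×′ 1#) * signed (sign j) (∣ j ∣ ×′ 1#)   ≈⟨ *-cong (⟦sign◃∣∣⟧ i) (⟦sign◃∣∣⟧ j) ⟨
    ⟦ i ⟧ℤ * ⟦ j ⟧ℤ                                              ∎
    where
    s : Sign
    s = sign i Sign.* sign j

  -‿homo : ∀ i → ⟦ ℤ.- i ⟧ℤ ≈ - ⟦ i ⟧ℤ
  -‿homo (+ zero)  = sym -0#≈0#
  -‿homo (+ suc n) = refl
  -‿homo -[1+ n ]  = sym (-‿involutive _)

  morphism : ℤ.+-*-rawRing -Raw-AlmostCommutative⟶ fromCommutativeRing R
  morphism = record
    { ⟦_⟧    = ⟦_⟧ℤ
    ; +-homo = +-homo
    ; *-homo = *-homo
    ; -‿homo = -‿homo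
    ; 0-homo = refl
    ; 1-homo = refl
    }

  private
    _≟ℤ_ : ∀ i j → Maybe (⟦ i ⟧ℤ ≈ ⟦ j ⟧ℤ)
    i ≟ℤ j with i ℤ.≟ j
    ... | yes ≡.refl = just refl
    ... | no _       = nothing

  open import Algebra.Solver.Ring ℤ.+-*-rawRing (fromCommutativeRing R) morphism _≟ℤ_ public

  polynomialRing : ℕ → RawRing 0ℓ 0ℓ
  polynomialRing n = record
    { Carrier = Polynomial n
    ; _≈_     = _≡_
    ; _+_     = _:+_
    ; _*_     = _:*_
    ; -_      = :-_
    ; 0#      = con (+ 0)
    ; 1#      = con (+ 1)
    }

open import Defs

module FieldProperties {c ℓ} (F : CommutativeRing c ℓ) (fld : IsField F) where
  open CommutativeRing F
  open import Algebra.Properties.Group +-group using (x∙y⁻¹≈ε⇒x≈y; x≈y⇒x∙y⁻¹≈ε)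
  open import Algebra.Properties.Ring ring using (-‿distribʳ-*)
  open import Relation.Binary.Reasoning.Setoid setoid

  1≉0 : ¬ 1# ≈ 0#
  1≉0 1≈0 = proj₁ fld (sym 1≈0)

  x*y≈0⇒x≈0 : ∀ {x y} → x * y ≈ 0# → ¬ y ≈ 0# → x ≈ 0#
  x*y≈0⇒x≈0 {x} {y} xy≈0 y≉0 with proj₂ fld y y≉0
  ... | y⁻¹ , yy⁻¹≈1 = begin
    x               ≈⟨ *-identityʳ x ⟨
    x * 1#          ≈⟨ *-congˡ yy⁻¹≈1 ⟨
    x * (y * y⁻¹)   ≈⟨ *-assoc x y y⁻¹ ⟨
    (x * y) * y⁻¹   ≈⟨ *-congʳ xy≈0 ⟩
    0# * y⁻¹        ≈⟨ zeroˡ y⁻¹ ⟩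
    0#              ∎

  x≉0∧y≉0⇒x*y≉0 : ∀ {x y} → ¬ x ≈ 0# → ¬ y ≈ 0# → ¬ x * y ≈ 0#
  x≉0∧y≉0⇒x*y≉0 x≉0 y≉0 xy≈0 = x≉0 (x*y≈0⇒x≈0 xy≈0 y≉0)

  x≉y⇒x-y≉0 : ∀ {x y} → ¬ x ≈ y → ¬ x - y ≈ 0#
  x≉y⇒x-y≉0 {x} {y} x≉y x-y≈0 = x≉y (x∙y⁻¹≈ε⇒x≈y x y x-y≈0)

  *-cancelˡ : ∀ {c x y} → ¬ c ≈ 0# → c * x ≈ c * y → x ≈ y
  *-cancelˡ {c} {x} {y} c≉0 cx≈cy = x∙y⁻¹≈ε⇒x≈y x y (x*y≈0⇒x≈0 (begin
    (x - y) * c        ≈⟨ *-comm (x - y) c ⟩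
    c * (x - y)        ≈⟨ distribˡ c x (- y) ⟩
    c * x + c * - y    ≈⟨ +-congˡ (sym (-‿distribʳ-* c y)) ⟩
    c * x - c * y      ≈⟨ x≈y⇒x∙y⁻¹≈ε cx≈cy ⟩
    0#                 ∎) c≉0)

  ≉0-resp-≈ : ∀ {x y} → ¬ x ≈ 0# → x ≈ y → ¬ y ≈ 0#
  ≉0-resp-≈ x≉0 x≈y y≈0 = x≉0 (trans x≈y y≈0)

module LinearAlgebra {c ℓ} (F : CommutativeRing c ℓ) (fld : IsField F) where
  open CommutativeRing F
  open FieldProperties F fld
  open IntegerCoefficients F using (solve; _:=_; polynomialRing)
  open Formulas rawRing
    using (⟪_,_⟫; vec₃; vec₄; _×₃_; det₃; basis₃; cofactors; adjugateColumn; exchange)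
  open import Algebra.Properties.Monoid.Sum +-monoid using (sum; sum-cong-≋; sum-cong-≗; sum-replicate-zero)
  open import Algebra.Properties.CommutativeMonoid.Sum +-commutativeMonoid using (∑-comm; ∑-permute)
  open import Algebra.Properties.Semiring.Sum semiring using (*-distribˡ-sum)
  open import Algebra.Properties.CommutativeSemigroup *-commutativeSemigroup using (x∙yz≈y∙xz)
  open import Algebra.Properties.Ring ring using (-‿involutive; -0#≈0#)
  open import Data.Fin.Permutation using (Permutation′; _⟨$⟩ʳ_; _⟨$⟩ˡ_; inverseˡ; transpose)
  open import Data.Vec.Relation.Unary.All.Properties using (lookup⁺)
  open import Relation.Binary.Reasoning.Setoid setoid
  private
    module S {n} = Formulas (polynomialRing n)

    variable
      k m n : ℕ

  column : Vec (Vector Carrier n) k → Fin n → Vector Carrier k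
  column v i j = lookup v j i

  sum-zero : ∀ {f : Vector Carrier n} → (∀ i → f i ≈ 0#) → sum f ≈ 0#
  sum-zero {n} f≈0 = trans (sum-cong-≋ f≈0) (sum-replicate-zero n)

  ⟪⟫-zeroʳ : ∀ (h : Vector Carrier n) {v} → (∀ i → v i ≈ 0#) → ⟪ h , v ⟫ ≈ 0#
  ⟪⟫-zeroʳ h v≈0 = sum-zero (λ i → trans (*-congˡ (v≈0 i)) (zeroʳ (h i)))

  ⟪⟫-comm : ∀ (h v : Vector Carrier n) → ⟪ h , v ⟫ ≈ ⟪ v , h ⟫
  ⟪⟫-comm h v = sum-cong-≋ (λ i → *-comm (h i) (v i))

  ⟪⟫-combination : ∀ (h : Vector Carrier n) (a : Vector Carrier k) v →
                   ⟪ h , (λ i → ⟪ a , column v i ⟫) ⟫ ≈ ⟪ a , (λ j → ⟪ h , lookup v j ⟫) ⟫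
  ⟪⟫-combination h a v = begin
    sum (λ i → h i * sum (λ j → a j * w j i))
      ≈⟨ sum-cong-≋ (λ i → *-distribˡ-sum (h i) (λ j → a j * w j i)) ⟩
    sum (λ i → sum (λ j → h i * (a j * w j i)))
      ≈⟨ ∑-comm (λ i j → h i * (a j * w j i)) ⟩
    sum (λ j → sum (λ i → h i * (a j * w j i)))
      ≈⟨ sum-cong-≋ (λ j → sum-cong-≋ (λ i → x∙yz≈y∙xz (h i) (a j) (w j i))) ⟩
    sum (λ j → sum (λ i → a j * (h i * w j i)))
      ≈⟨ sum-cong-≋ (λ j → *-distribˡ-sum (a j) (λ i → h i * w j i)) ⟨
    sum (λ j → a j * sum (λ i → h i * w j i))
      ∎
    where
    w = lookup v

  ⟪basis₃⟫ : ∀ l (y : Vector Carrier 3) → ⟪ basis₃ l , y ⟫ ≈ y l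
  ⟪basis₃⟫ 0F y = solve 3 (λ y₀ y₁ y₂ → S.⟪ S.basis₃ 0F , S.vec₃ y₀ y₁ y₂ ⟫ := y₀) refl (y 0F) (y 1F) (y 2F)
  ⟪basis₃⟫ 1F y = solve 3 (λ y₀ y₁ y₂ → S.⟪ S.basis₃ 1F , S.vec₃ y₀ y₁ y₂ ⟫ := y₁) refl (y 0F) (y 1F) (y 2F)
  ⟪basis₃⟫ 2F y = solve 3 (λ y₀ y₁ y₂ → S.⟪ S.basis₃ 2F , S.vec₃ y₀ y₁ y₂ ⟫ := y₂) refl (y 0F) (y 1F) (y 2F)

  combination-zero : ∀ (a : Vector Carrier k) (x : Vec (Vector Carrier 3) k) →
                     (∀ f → ⟪ a , (λ j → ⟪ f , lookup x j ⟫) ⟫ ≈ 0#) → ∀ l → ⟪ a , column x l ⟫ ≈ 0#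
  combination-zero a x ax≈0 l = begin
    ⟪ a , column x l ⟫                         ≈⟨ sum-cong-≋ (λ j → *-congˡ (⟪basis₃⟫ l (lookup x j))) ⟨
    ⟪ a , (λ j → ⟪ basis₃ l , lookup x j ⟫) ⟫   ≈⟨ ax≈0 (basis₃ l) ⟩
    0#                                         ∎

  -- Opaque, so that Independent (v ∷ vs) is unified as such rather than through its unfolding.
  opaque
    Independent : Vec (Vector Carrier n) k → Set (c ⊔ ℓ)
    Independent v = ∀ a → (∀ i → ⟪ a , column v i ⟫ ≈ 0#) → ∀ j → a j ≈ 0#

    independent-[] : Independent {n} []
    independent-[] a _ ()

    independent-∷ : ∀ {h v : Vector Carrier n} {vs : Vec (Vector Carrier n) k} → ¬ ⟪ h , v ⟫ ≈ 0# →
                    All (λ w → ⟪ h , w ⟫ ≈ 0#) vs → Independent vs → Independent (v ∷ vs)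
    independent-∷ {h = h} {v} {vs} hv≉0 hvs≈0 ind a av≈0 = λ where
        0F      → a₀≈0
        (suc j) → ind (λ j → a (suc j)) rest≈0 j
      where
      a₀≈0 : a 0F ≈ 0#
      a₀≈0 = x*y≈0⇒x≈0 (begin
        a 0F * ⟪ h , v ⟫                          ≈⟨ +-identityʳ _ ⟨
        a 0F * ⟪ h , v ⟫ + 0#
          ≈⟨ +-congˡ (sum-zero (λ j → trans (*-congˡ (lookup⁺ hvs≈0 j)) (zeroʳ _))) ⟨
        ⟪ a , (λ j → ⟪ h , lookup (v ∷ vs) j ⟫) ⟫  ≈⟨ ⟪⟫-combination h a (v ∷ vs) ⟨
        ⟪ h , (λ i → ⟪ a , column (v ∷ vs) i ⟫) ⟫  ≈⟨ ⟪⟫-zeroʳ h av≈0 ⟩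
        0#                                        ∎) hv≉0
      rest≈0 : ∀ i → ⟪ (λ j → a (suc j)) , column vs i ⟫ ≈ 0#
      rest≈0 i = begin
        ⟪ (λ j → a (suc j)) , column vs i ⟫        ≈⟨ +-identityˡ _ ⟨
        0# + ⟪ (λ j → a (suc j)) , column vs i ⟫   ≈⟨ +-congʳ (trans (*-congʳ a₀≈0) (zeroˡ (v i))) ⟨
        ⟪ a , column (v ∷ vs) i ⟫                 ≈⟨ av≈0 i ⟩
        0#                                        ∎

    independent-cong-head : ∀ {v w : Vector Carrier n} {vs : Vec (Vector Carrier n) k} →
                            (∀ i → w i ≈ v i) → Independent (v ∷ vs) → Independent (w ∷ vs)
    independent-cong-head w≈v ind a aw≈0 = ind a (λ i → trans (+-congʳ (*-congˡ (sym (w≈v i)))) (aw≈0 i))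

    independent-reindex : ∀ {v w : Vec (Vector Carrier n) k} (π : Permutation′ k) →
                          (∀ j → lookup w j ≡ lookup v (π ⟨$⟩ʳ j)) → Independent v → Independent w
    independent-reindex {v = v} {w} π w≡vπ ind a aw≈0 j = begin
      a j                          ≡⟨ ≡.cong a (inverseˡ π) ⟨
      a (π ⟨$⟩ˡ (π ⟨$⟩ʳ j))        ≈⟨ ind (λ l → a (π ⟨$⟩ˡ l)) bv≈0 (π ⟨$⟩ʳ j) ⟩
      0#                           ∎
      where
      bv≈0 : ∀ i → ⟪ (λ l → a (π ⟨$⟩ˡ l)) , column v i ⟫ ≈ 0#
      bv≈0 i = begin
        sum (λ l → a (π ⟨$⟩ˡ l) * lookup v l i)
          ≈⟨ ∑-permute _ π ⟩
        sum (λ l → a (π ⟨$⟩ˡ (π ⟨$⟩ʳ l)) * lookup v (π ⟨$⟩ʳ l) i)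
          ≡⟨ sum-cong-≗ (λ l → ≡.cong₂ (λ x y → a x * y i) (inverseˡ π) (≡.sym (w≡vπ l))) ⟩
        sum (λ l → a l * lookup w l i)
          ≈⟨ aw≈0 i ⟩
        0#
          ∎

    independent-rescale : ∀ {v w : Vec (Vector Carrier n) k} (s : Vector Carrier k) → (∀ j → ¬ s j ≈ 0#) →
                          (∀ j i → lookup w j i ≈ s j * lookup v j i) → Independent v → Independent w
    independent-rescale {v = v} {w} s s≉0 w≈sv ind a aw≈0 j =
      x*y≈0⇒x≈0 (ind (λ l → a l * s l) asv≈0 j) (s≉0 j)
      where
      asv≈0 : ∀ i → ⟪ (λ l → a l * s l) , column v i ⟫ ≈ 0#
      asv≈0 i = begin
        sum (λ l → a l * s l * lookup v l i)
          ≈⟨ sum-cong-≋ (λ l → trans (*-assoc (a l) (s l) _) (*-congˡ (sym (w≈sv l i)))) ⟩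
        sum (λ l → a l * lookup w l i)
          ≈⟨ aw≈0 i ⟩
        0#
          ∎

    independent-coordinates : ∀ {v : Vec (Vector Carrier n) k} {x : Vec (Vector Carrier m) k}
                              (u : Vec (Vector Carrier n) m) → (∀ j i → lookup v j i ≈ ⟪ lookup x j , column u i ⟫) →
                              Independent v → Independent x
    independent-coordinates {v = v} {x} u v≈xu ind a ax≈0 = ind a av≈0
      where
      av≈0 : ∀ i → ⟪ a , column v i ⟫ ≈ 0#
      av≈0 i = begin
        ⟪ a , column v i ⟫
          ≈⟨ sum-cong-≋ (λ j → *-congˡ (trans (v≈xu j i) (⟪⟫-comm (lookup x j) _))) ⟩
        ⟪ a , (λ j → ⟪ column u i , lookup x j ⟫) ⟫
          ≈⟨ ⟪⟫-combination (column u i) a x ⟨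
        ⟪ column u i , (λ l → ⟪ a , column x l ⟫) ⟫
          ≈⟨ ⟪⟫-zeroʳ (column u i) ax≈0 ⟩
        0#
          ∎

  module _ {p q r s : Vector Carrier n} where
    swap₁₂ : Independent (p ∷ q ∷ r ∷ s ∷ []) → Independent (q ∷ p ∷ r ∷ s ∷ [])
    swap₁₂ = independent-reindex (transpose 0F 1F) λ where 0F → ≡.refl ; 1F → ≡.refl ; 2F → ≡.refl ; 3F → ≡.refl

    swap₂₃ : Independent (p ∷ q ∷ r ∷ s ∷ []) → Independent (p ∷ r ∷ q ∷ s ∷ [])
    swap₂₃ = independent-reindex (transpose 1F 2F) λ where 0F → ≡.refl ; 1F → ≡.refl ; 2F → ≡.refl ; 3F → ≡.refl

    swap₃₄ : Independent (p ∷ q ∷ r ∷ s ∷ []) → Independent (p ∷ q ∷ s ∷ r ∷ [])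
    swap₃₄ = independent-reindex (transpose 2F 3F) λ where 0F → ≡.refl ; 1F → ≡.refl ; 2F → ≡.refl ; 3F → ≡.refl

  module _ (a₀ b₀ c₀ a₁ b₁ c₁ a₂ b₂ c₂ a₃ b₃ c₃ : Carrier) where
    private
      x : Vec (Vector Carrier 3) 4
      x = vec₃ a₀ b₀ c₀ ∷ vec₃ a₁ b₁ c₁ ∷ vec₃ a₂ b₂ c₂ ∷ vec₃ a₃ b₃ c₃ ∷ []

      x₀ x₁ x₂ : Vector Carrier 3
      x₀ = lookup x 0F
      x₁ = lookup x 1F
      x₂ = lookup x 2F

      ⟪_,x⟫ : Vector Carrier 3 → Vector Carrier 4
      ⟪ f ,x⟫ j = ⟪ f , lookup x j ⟫

    laplace : ∀ e → ⟪ cofactors (lookup x) , ⟪ e ,x⟫ ⟫ ≈ 0#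
    laplace e = solve 15 (λ a₀ b₀ c₀ a₁ b₁ c₁ a₂ b₂ c₂ a₃ b₃ c₃ e₀ e₁ e₂ →
        let x = S.vec₃ a₀ b₀ c₀ ∷ S.vec₃ a₁ b₁ c₁ ∷ S.vec₃ a₂ b₂ c₂ ∷ S.vec₃ a₃ b₃ c₃ ∷ []
        in S.⟪ S.cofactors (lookup x) , (λ j → S.⟪ S.vec₃ e₀ e₁ e₂ , lookup x j ⟫) ⟫ := S.0#) refl
      a₀ b₀ c₀ a₁ b₁ c₁ a₂ b₂ c₂ a₃ b₃ c₃ (e 0F) (e 1F) (e 2F)

    adjugate : ∀ e f → ⟪ adjugateColumn e (lookup x) , ⟪ f ,x⟫ ⟫ ≈ det₃ x₀ x₁ x₂ * ⟪ e , f ⟫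
    adjugate e f = solve 18 (λ a₀ b₀ c₀ a₁ b₁ c₁ a₂ b₂ c₂ a₃ b₃ c₃ e₀ e₁ e₂ f₀ f₁ f₂ →
        let x = S.vec₃ a₀ b₀ c₀ ∷ S.vec₃ a₁ b₁ c₁ ∷ S.vec₃ a₂ b₂ c₂ ∷ S.vec₃ a₃ b₃ c₃ ∷ []
            e = S.vec₃ e₀ e₁ e₂
            f = S.vec₃ f₀ f₁ f₂
        in S.⟪ S.adjugateColumn e (lookup x) , (λ j → S.⟪ f , lookup x j ⟫) ⟫
           := S.det₃ (lookup x 0F) (lookup x 1F) (lookup x 2F) S.* S.⟪ e , f ⟫) refl
      a₀ b₀ c₀ a₁ b₁ c₁ a₂ b₂ c₂ a₃ b₃ c₃ (e 0F) (e 1F) (e 2F) (f 0F) (f 1F) (f 2F)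

    binet-cauchy : ∀ e f → ⟪ exchange e (lookup x) , ⟪ f ,x⟫ ⟫ ≈ ⟪ e ×₃ f , x₀ ×₃ x₁ ⟫
    binet-cauchy e f = solve 18 (λ a₀ b₀ c₀ a₁ b₁ c₁ a₂ b₂ c₂ a₃ b₃ c₃ e₀ e₁ e₂ f₀ f₁ f₂ →
        let x = S.vec₃ a₀ b₀ c₀ ∷ S.vec₃ a₁ b₁ c₁ ∷ S.vec₃ a₂ b₂ c₂ ∷ S.vec₃ a₃ b₃ c₃ ∷ []
            e = S.vec₃ e₀ e₁ e₂
            f = S.vec₃ f₀ f₁ f₂
        in S.⟪ S.exchange e (lookup x) , (λ j → S.⟪ f , lookup x j ⟫) ⟫
           := S.⟪ e S.×₃ f , lookup x 0F S.×₃ lookup x 1F ⟫) refl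
      a₀ b₀ c₀ a₁ b₁ c₁ a₂ b₂ c₂ a₃ b₃ c₃ (e 0F) (e 1F) (e 2F) (f 0F) (f 1F) (f 2F)

    first-row : ∀ f → ⟪ vec₄ 1# 0# 0# 0# , ⟪ f ,x⟫ ⟫ ≈ ⟪ f , x₀ ⟫
    first-row f = solve 15 (λ a₀ b₀ c₀ a₁ b₁ c₁ a₂ b₂ c₂ a₃ b₃ c₃ f₀ f₁ f₂ →
        let x = S.vec₃ a₀ b₀ c₀ ∷ S.vec₃ a₁ b₁ c₁ ∷ S.vec₃ a₂ b₂ c₂ ∷ S.vec₃ a₃ b₃ c₃ ∷ []
            f = S.vec₃ f₀ f₁ f₂
        in S.⟪ S.vec₄ S.1# S.0# S.0# S.0# , (λ j → S.⟪ f , lookup x j ⟫) ⟫ := S.⟪ f , lookup x 0F ⟫) refl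
      a₀ b₀ c₀ a₁ b₁ c₁ a₂ b₂ c₂ a₃ b₃ c₃ (f 0F) (f 1F) (f 2F)

    opaque
      unfolding Independent

      -- The cofactor relation forces det(x₀, x₁, x₂) = 0, the adjugate relation then forces
      -- x₀ × x₁ = 0, and the Binet–Cauchy relation finally forces x₀ = 0.
      ¬independent₄-in-F³ : ¬ Independent x
      ¬independent₄-in-F³ ind = 1≉0 (trivial (vec₄ 1# 0# 0# 0#) (λ f → trans (first-row f) (x₀≈0 f)) 0F)
        where
        trivial : ∀ a → (∀ f → ⟪ a , ⟪ f ,x⟫ ⟫ ≈ 0#) → ∀ j → a j ≈ 0#
        trivial a ax≈0 = ind a (combination-zero a x ax≈0)
        det≈0 : det₃ x₀ x₁ x₂ ≈ 0#
        det≈0 = trans (sym (-‿involutive _)) (trans (-‿cong (trivial (cofactors (lookup x)) laplace 3F)) -0#≈0#)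
        cross≈0 : ∀ e → ⟪ e , x₀ ×₃ x₁ ⟫ ≈ 0#
        cross≈0 e = trivial (adjugateColumn e (lookup x)) (λ f → trans (adjugate e f) (trans (*-congʳ det≈0) (zeroˡ _))) 2F
        x₀≈0 : ∀ f → ⟪ f , x₀ ⟫ ≈ 0#
        x₀≈0 f = trivial (exchange f (lookup x)) (λ e → trans (binet-cauchy f e) (cross≈0 (f ×₃ e))) 1F

  ¬independent-in-plane : ∀ {p₁ p₂ p₃ p₄ u v w : V5 F} → Independent (p₁ ∷ p₂ ∷ p₃ ∷ p₄ ∷ []) →
    InSpan3 F u v w p₁ → InSpan3 F u v w p₂ → InSpan3 F u v w p₃ → InSpan3 F u v w p₄ → ⊥
  ¬independent-in-plane {p₁} {p₂} {p₃} {p₄} {u} {v} {w} ind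
    (a₁ , b₁ , c₁ , p₁≈) (a₂ , b₂ , c₂ , p₂≈) (a₃ , b₃ , c₃ , p₃≈) (a₄ , b₄ , c₄ , p₄≈) =
    ¬independent₄-in-F³ a₁ b₁ c₁ a₂ b₂ c₂ a₃ b₃ c₃ a₄ b₄ c₄ (independent-coordinates basis p≈xu ind)
    where
    basis : Vec (V5 F) 3
    basis = u ∷ v ∷ w ∷ []
    lin3≈⟪⟫ : ∀ a b c i → lin3 F a u b v c w i ≈ ⟪ vec₃ a b c , column basis i ⟫
    lin3≈⟪⟫ a b c i = solve 6 (λ a b c x y z → a S.* x S.+ b S.* y S.+ c S.* z := S.⟪ S.vec₃ a b c , S.vec₃ x y z ⟫)
      refl a b c (u i) (v i) (w i)
    p≈xu : ∀ j i → lookup (p₁ ∷ p₂ ∷ p₃ ∷ p₄ ∷ []) j i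
                 ≈ ⟪ lookup (vec₃ a₁ b₁ c₁ ∷ vec₃ a₂ b₂ c₂ ∷ vec₃ a₃ b₃ c₃ ∷ vec₃ a₄ b₄ c₄ ∷ []) j , column basis i ⟫
    p≈xu 0F i = trans (p₁≈ i) (lin3≈⟪⟫ a₁ b₁ c₁ i)
    p≈xu 1F i = trans (p₂≈ i) (lin3≈⟪⟫ a₂ b₂ c₂ i)
    p≈xu 2F i = trans (p₃≈ i) (lin3≈⟪⟫ a₃ b₃ c₃ i)
    p≈xu 3F i = trans (p₄≈ i) (lin3≈⟪⟫ a₄ b₄ c₄ i)

module NormalCurve {c ℓ} (F : CommutativeRing c ℓ) where
  open CommutativeRing F
  open IntegerCoefficients F using (solve; _:=_; polynomialRing)
  open Formulas rawRing public
    using ( ⟪_,_⟫; vec₄; [1]; [x]; [x⁴]; [x-_]; _·_; _-valueAt_; criticalCubic; criticalQuartic; throughTangent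
          ; squaredQuadratic; centred; form₃; form₂)
  private
    module S {n} = Formulas (polynomialRing n)

  C T : Carrier → V5 F
  C = curvePt F
  T = tangentPt F

  I : V5 F
  I = infPt F

  curve-cong : ∀ {s t} → s ≈ t → ∀ i → C s i ≈ C t i
  curve-cong s≈t 0F = refl
  curve-cong s≈t 1F = s≈t
  curve-cong s≈t 2F = *-cong s≈t s≈t
  curve-cong s≈t 3F = *-cong (*-cong s≈t s≈t) s≈t
  curve-cong s≈t 4F = *-cong (*-cong (*-cong s≈t s≈t) s≈t) s≈t

  tangent-cong : ∀ {s t} → s ≈ t → ∀ i → T s i ≈ T t i
  tangent-cong s≈t 0F = refl
  tangent-cong s≈t 1F = refl
  tangent-cong s≈t 2F = *-congˡ s≈t
  tangent-cong s≈t 3F = *-congˡ (*-cong s≈t s≈t)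
  tangent-cong s≈t 4F = *-congˡ (*-cong (*-cong s≈t s≈t) s≈t)

  [1]-curve : ∀ t → ⟪ [1] , C t ⟫ ≈ 1#
  [1]-curve = solve 1 (λ t → S.⟪ S.[1] , S.curve t ⟫ := S.1#) refl

  [1]-tangent : ∀ t → ⟪ [1] , T t ⟫ ≈ 0#
  [1]-tangent = solve 1 (λ t → S.⟪ S.[1] , S.tangent t ⟫ := S.0#) refl

  [1]-infinity : ⟪ [1] , I ⟫ ≈ 0#
  [1]-infinity = solve 0 (S.⟪ S.[1] , S.infinity ⟫ := S.0#) refl

  [x]-tangent : ∀ t → ⟪ [x] , T t ⟫ ≈ 1#
  [x]-tangent = solve 1 (λ t → S.⟪ S.[x] , S.tangent t ⟫ := S.1#) refl

  [x]-infinity : ⟪ [x] , I ⟫ ≈ 0#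
  [x]-infinity = solve 0 (S.⟪ S.[x] , S.infinity ⟫ := S.0#) refl

  [x⁴]-infinity : ⟪ [x⁴] , I ⟫ ≈ 1#
  [x⁴]-infinity = solve 0 (S.⟪ S.[x⁴] , S.infinity ⟫ := S.1#) refl

  linear-curve : ∀ a t → ⟪ [x- a ] , C t ⟫ ≈ t - a
  linear-curve = solve 2 (λ a t → S.⟪ S.[x- a ] , S.curve t ⟫ := t S.- a) refl

  linear-root : ∀ a → ⟪ [x- a ] , C a ⟫ ≈ 0#
  linear-root = solve 1 (λ a → S.⟪ S.[x- a ] , S.curve a ⟫ := S.0#) refl

  linear-infinity : ∀ a → ⟪ [x- a ] , I ⟫ ≈ 0#
  linear-infinity = solve 1 (λ a → S.⟪ S.[x- a ] , S.infinity ⟫ := S.0#) refl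

  quadratic-curve : ∀ a b t → ⟪ [x- a ] · [x- b ] , C t ⟫ ≈ (t - a) * (t - b)
  quadratic-curve = solve 3 (λ a b t →
    S.⟪ S.[x- a ] S.· S.[x- b ] , S.curve t ⟫ := (t S.- a) S.* (t S.- b)) refl

  quadratic-root₁ : ∀ a b → ⟪ [x- a ] · [x- b ] , C a ⟫ ≈ 0#
  quadratic-root₁ = solve 2 (λ a b → S.⟪ S.[x- a ] S.· S.[x- b ] , S.curve a ⟫ := S.0#) refl

  quadratic-root₂ : ∀ a b → ⟪ [x- a ] · [x- b ] , C b ⟫ ≈ 0#
  quadratic-root₂ = solve 2 (λ a b → S.⟪ S.[x- a ] S.· S.[x- b ] , S.curve b ⟫ := S.0#) refl

  quadratic-infinity : ∀ a b → ⟪ [x- a ] · [x- b ] , I ⟫ ≈ 0#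
  quadratic-infinity = solve 2 (λ a b → S.⟪ S.[x- a ] S.· S.[x- b ] , S.infinity ⟫ := S.0#) refl

  cubic-curve : ∀ a b c t → ⟪ [x- a ] · [x- b ] · [x- c ] , C t ⟫ ≈ (t - a) * (t - b) * (t - c)
  cubic-curve = solve 4 (λ a b c t →
    S.⟪ S.[x- a ] S.· S.[x- b ] S.· S.[x- c ] , S.curve t ⟫ := (t S.- a) S.* (t S.- b) S.* (t S.- c)) refl

  cubic-root₁ : ∀ a b c → ⟪ [x- a ] · [x- b ] · [x- c ] , C a ⟫ ≈ 0#
  cubic-root₁ = solve 3 (λ a b c → S.⟪ S.[x- a ] S.· S.[x- b ] S.· S.[x- c ] , S.curve a ⟫ := S.0#) refl

  cubic-root₂ : ∀ a b c → ⟪ [x- a ] · [x- b ] · [x- c ] , C b ⟫ ≈ 0#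
  cubic-root₂ = solve 3 (λ a b c → S.⟪ S.[x- a ] S.· S.[x- b ] S.· S.[x- c ] , S.curve b ⟫ := S.0#) refl

  cubic-root₃ : ∀ a b c → ⟪ [x- a ] · [x- b ] · [x- c ] , C c ⟫ ≈ 0#
  cubic-root₃ = solve 3 (λ a b c → S.⟪ S.[x- a ] S.· S.[x- b ] S.· S.[x- c ] , S.curve c ⟫ := S.0#) refl

  square-tangent : ∀ b t → ⟪ [x- b ] · [x- b ] , T t ⟫ ≈ 2# F * (t - b)
  square-tangent = solve 2 (λ b t → S.⟪ S.[x- b ] S.· S.[x- b ] , S.tangent t ⟫ := S.2# S.* (t S.- b)) refl

  square-critical : ∀ b → ⟪ [x- b ] · [x- b ] , T b ⟫ ≈ 0#
  square-critical = solve 1 (λ b → S.⟪ S.[x- b ] S.· S.[x- b ] , S.tangent b ⟫ := S.0#) refl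

  square-infinity : ∀ b → ⟪ [x- b ] · [x- b ] , I ⟫ ≈ 0#
  square-infinity = solve 1 (λ b → S.⟪ S.[x- b ] S.· S.[x- b ] , S.infinity ⟫ := S.0#) refl

  linearSquare-curve : ∀ a b t → ⟪ [x- a ] · [x- b ] · [x- b ] , C t ⟫ ≈ (t - a) * (t - b) * (t - b)
  linearSquare-curve = solve 3 (λ a b t →
    S.⟪ S.[x- a ] S.· S.[x- b ] S.· S.[x- b ] , S.curve t ⟫ := (t S.- a) S.* (t S.- b) S.* (t S.- b)) refl

  linearSquare-root : ∀ a b → ⟪ [x- a ] · [x- b ] · [x- b ] , C a ⟫ ≈ 0#
  linearSquare-root = solve 2 (λ a b → S.⟪ S.[x- a ] S.· S.[x- b ] S.· S.[x- b ] , S.curve a ⟫ := S.0#) refl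

  linearSquare-critical : ∀ a b → ⟪ [x- a ] · [x- b ] · [x- b ] , T b ⟫ ≈ 0#
  linearSquare-critical = solve 2 (λ a b →
    S.⟪ S.[x- a ] S.· S.[x- b ] S.· S.[x- b ] , S.tangent b ⟫ := S.0#) refl

  linearSquare-infinity : ∀ a b → ⟪ [x- a ] · [x- b ] · [x- b ] , I ⟫ ≈ 0#
  linearSquare-infinity = solve 2 (λ a b →
    S.⟪ S.[x- a ] S.· S.[x- b ] S.· S.[x- b ] , S.infinity ⟫ := S.0#) refl

  symmetric-curve : ∀ a b → ⟪ [x- a ] · [x- 2# F * b - a ] , C b ⟫ ≈ (b - a) * (a - b)
  symmetric-curve = solve 2 (λ a b →
    S.⟪ S.[x- a ] S.· S.[x- S.2# S.* b S.- a ] , S.curve b ⟫ := (b S.- a) S.* (a S.- b)) refl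

  symmetric-root : ∀ a b → ⟪ [x- a ] · [x- 2# F * b - a ] , C a ⟫ ≈ 0#
  symmetric-root = solve 2 (λ a b → S.⟪ S.[x- a ] S.· S.[x- S.2# S.* b S.- a ] , S.curve a ⟫ := S.0#) refl

  symmetric-critical : ∀ a b → ⟪ [x- a ] · [x- 2# F * b - a ] , T b ⟫ ≈ 0#
  symmetric-critical = solve 2 (λ a b → S.⟪ S.[x- a ] S.· S.[x- S.2# S.* b S.- a ] , S.tangent b ⟫ := S.0#) refl

  symmetric-infinity : ∀ a b → ⟪ [x- a ] · [x- 2# F * b - a ] , I ⟫ ≈ 0#
  symmetric-infinity = solve 2 (λ a b → S.⟪ S.[x- a ] S.· S.[x- S.2# S.* b S.- a ] , S.infinity ⟫ := S.0#) refl

  squareQuadratic-curve : ∀ b a₂ a₃ t → ⟪ [x- b ] · [x- b ] · [x- a₂ ] · [x- a₃ ] , C t ⟫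
    ≈ (t - b) * (t - b) * (t - a₂) * (t - a₃)
  squareQuadratic-curve = solve 4 (λ b a₂ a₃ t →
    S.⟪ S.[x- b ] S.· S.[x- b ] S.· S.[x- a₂ ] S.· S.[x- a₃ ] , S.curve t ⟫
    := (t S.- b) S.* (t S.- b) S.* (t S.- a₂) S.* (t S.- a₃)) refl

  squareQuadratic-critical : ∀ b a₂ a₃ → ⟪ [x- b ] · [x- b ] · [x- a₂ ] · [x- a₃ ] , T b ⟫ ≈ 0#
  squareQuadratic-critical = solve 3 (λ b a₂ a₃ →
    S.⟪ S.[x- b ] S.· S.[x- b ] S.· S.[x- a₂ ] S.· S.[x- a₃ ] , S.tangent b ⟫ := S.0#) refl

  squareQuadratic-root₂ : ∀ b a₂ a₃ → ⟪ [x- b ] · [x- b ] · [x- a₂ ] · [x- a₃ ] , C a₂ ⟫ ≈ 0#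
  squareQuadratic-root₂ = solve 3 (λ b a₂ a₃ →
    S.⟪ S.[x- b ] S.· S.[x- b ] S.· S.[x- a₂ ] S.· S.[x- a₃ ] , S.curve a₂ ⟫ := S.0#) refl

  squareQuadratic-root₃ : ∀ b a₂ a₃ → ⟪ [x- b ] · [x- b ] · [x- a₂ ] · [x- a₃ ] , C a₃ ⟫ ≈ 0#
  squareQuadratic-root₃ = solve 3 (λ b a₂ a₃ →
    S.⟪ S.[x- b ] S.· S.[x- b ] S.· S.[x- a₂ ] S.· S.[x- a₃ ] , S.curve a₃ ⟫ := S.0#) refl

  throughTangent-curve : ∀ b a₂ a₃ → ⟪ throughTangent b a₂ a₃ , C b ⟫
    ≈ (a₂ - b) * (a₃ - b) * ((a₂ - b) * (a₃ - b))
  throughTangent-curve = solve 3 (λ b a₂ a₃ →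
    S.⟪ S.throughTangent b a₂ a₃ , S.curve b ⟫
    := (a₂ S.- b) S.* (a₃ S.- b) S.* ((a₂ S.- b) S.* (a₃ S.- b))) refl

  throughTangent-critical : ∀ b a₂ a₃ → ⟪ throughTangent b a₂ a₃ , T b ⟫ ≈ 0#
  throughTangent-critical = solve 3 (λ b a₂ a₃ → S.⟪ S.throughTangent b a₂ a₃ , S.tangent b ⟫ := S.0#) refl

  throughTangent-root₂ : ∀ b a₂ a₃ → ⟪ throughTangent b a₂ a₃ , C a₂ ⟫ ≈ 0#
  throughTangent-root₂ = solve 3 (λ b a₂ a₃ → S.⟪ S.throughTangent b a₂ a₃ , S.curve a₂ ⟫ := S.0#) refl

  throughTangent-root₃ : ∀ b a₂ a₃ → ⟪ throughTangent b a₂ a₃ , C a₃ ⟫ ≈ 0#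
  throughTangent-root₃ = solve 3 (λ b a₂ a₃ → S.⟪ S.throughTangent b a₂ a₃ , S.curve a₃ ⟫ := S.0#) refl

  criticalCubic-tangent : ∀ b c t → ⟪ criticalCubic b c , T t ⟫ ≈ 4# F * 3# F * ((t - b) * (t - c))
  criticalCubic-tangent = solve 3 (λ b c t →
    S.⟪ S.criticalCubic b c , S.tangent t ⟫ := S.4# S.* S.3# S.* ((t S.- b) S.* (t S.- c))) refl

  criticalCubic-critical₁ : ∀ b c → ⟪ criticalCubic b c , T b ⟫ ≈ 0#
  criticalCubic-critical₁ = solve 2 (λ b c → S.⟪ S.criticalCubic b c , S.tangent b ⟫ := S.0#) refl

  criticalCubic-critical₂ : ∀ b c → ⟪ criticalCubic b c , T c ⟫ ≈ 0#
  criticalCubic-critical₂ = solve 2 (λ b c → S.⟪ S.criticalCubic b c , S.tangent c ⟫ := S.0#) refl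

  criticalCubic-infinity : ∀ b c → ⟪ criticalCubic b c , I ⟫ ≈ 0#
  criticalCubic-infinity = solve 2 (λ b c → S.⟪ S.criticalCubic b c , S.infinity ⟫ := S.0#) refl

  criticalQuartic-tangent : ∀ b c d t → ⟪ criticalQuartic b c d , T t ⟫
    ≈ 4# F * 3# F * ((t - b) * (t - c) * (t - d))
  criticalQuartic-tangent = solve 4 (λ b c d t →
    S.⟪ S.criticalQuartic b c d , S.tangent t ⟫
    := S.4# S.* S.3# S.* ((t S.- b) S.* (t S.- c) S.* (t S.- d))) refl

  criticalQuartic-critical₁ : ∀ b c d → ⟪ criticalQuartic b c d , T b ⟫ ≈ 0#
  criticalQuartic-critical₁ = solve 3 (λ b c d → S.⟪ S.criticalQuartic b c d , S.tangent b ⟫ := S.0#) refl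

  criticalQuartic-critical₂ : ∀ b c d → ⟪ criticalQuartic b c d , T c ⟫ ≈ 0#
  criticalQuartic-critical₂ = solve 3 (λ b c d → S.⟪ S.criticalQuartic b c d , S.tangent c ⟫ := S.0#) refl

  criticalQuartic-critical₃ : ∀ b c d → ⟪ criticalQuartic b c d , T d ⟫ ≈ 0#
  criticalQuartic-critical₃ = solve 3 (λ b c d → S.⟪ S.criticalQuartic b c d , S.tangent d ⟫ := S.0#) refl

  criticalCubic-valueAt-curve : ∀ a b₁ b₂ t → ⟪ criticalCubic b₁ b₂ -valueAt a , C t ⟫
    ≈ (t - a) * form₃ (centred b₁ b₂ t) (centred b₁ b₂ a) (b₁ - b₂)
  criticalCubic-valueAt-curve = solve 4 (λ a b₁ b₂ t →
    S.⟪ S.criticalCubic b₁ b₂ S.-valueAt a , S.curve t ⟫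
    := (t S.- a) S.* S.form₃ (S.centred b₁ b₂ t) (S.centred b₁ b₂ a) (b₁ S.- b₂)) refl

  squaredQuadratic-valueAt-curve : ∀ a b₁ b₂ t → ⟪ squaredQuadratic b₁ b₂ -valueAt a , C t ⟫
    ≈ (t - a) * ((centred b₁ b₂ t + centred b₁ b₂ a) * form₂ (centred b₁ b₂ t) (centred b₁ b₂ a) (b₁ - b₂))
  squaredQuadratic-valueAt-curve = solve 4 (λ a b₁ b₂ t →
    S.⟪ S.squaredQuadratic b₁ b₂ S.-valueAt a , S.curve t ⟫
    := (t S.- a) S.* ((S.centred b₁ b₂ t S.+ S.centred b₁ b₂ a) S.* S.form₂ (S.centred b₁ b₂ t) (S.centred b₁ b₂ a) (b₁ S.- b₂))) refl

  squaredQuadratic-critical₁ : ∀ b₁ b₂ → ⟪ squaredQuadratic b₁ b₂ , T b₁ ⟫ ≈ 0#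
  squaredQuadratic-critical₁ = solve 2 (λ b₁ b₂ → S.⟪ S.squaredQuadratic b₁ b₂ , S.tangent b₁ ⟫ := S.0#) refl

  squaredQuadratic-critical₂ : ∀ b₁ b₂ → ⟪ squaredQuadratic b₁ b₂ , T b₂ ⟫ ≈ 0#
  squaredQuadratic-critical₂ = solve 2 (λ b₁ b₂ → S.⟪ S.squaredQuadratic b₁ b₂ , S.tangent b₂ ⟫ := S.0#) refl

  valueAt-root : ∀ p a → ⟪ p -valueAt a , C a ⟫ ≈ 0#
  valueAt-root p a = solve 6 (λ p₀ p₁ p₂ p₃ p₄ a → S.⟪ S.vec₅ p₀ p₁ p₂ p₃ p₄ S.-valueAt a , S.curve a ⟫ := S.0#) refl
    (p 0F) (p 1F) (p 2F) (p 3F) (p 4F) a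

  valueAt-tangent : ∀ p a t → ⟪ p -valueAt a , T t ⟫ ≈ ⟪ p , T t ⟫
  valueAt-tangent p a t = solve 7 (λ p₀ p₁ p₂ p₃ p₄ a t →
      S.⟪ S.vec₅ p₀ p₁ p₂ p₃ p₄ S.-valueAt a , S.tangent t ⟫ := S.⟪ S.vec₅ p₀ p₁ p₂ p₃ p₄ , S.tangent t ⟫) refl
    (p 0F) (p 1F) (p 2F) (p 3F) (p 4F) a t

module Track {c ℓ} (F : CommutativeRing c ℓ) (fld : IsField F)
  (_≟_ : ∀ x y → Dec (CommutativeRing._≈_ F x y)) (3-nonsquare : ¬ IsSquare F (3# F)) where
  open CommutativeRing F
  open FieldProperties F fld
  open LinearAlgebra F fld
  open NormalCurve F
  open IntegerCoefficients F using (solve; _:=_; polynomialRing)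
  open import Relation.Binary.Reasoning.Setoid setoid
  private
    module S {n} = Formulas (polynomialRing n)

  infixl 7 _⊛_
  _⊛_ : ∀ {x y} → ¬ x ≈ 0# → ¬ y ≈ 0# → ¬ x * y ≈ 0#
  _⊛_ = x≉0∧y≉0⇒x*y≉0

  diff : ∀ {x y} → ¬ x ≈ y → ¬ x - y ≈ 0#
  diff = x≉y⇒x-y≉0

  ≉-transport : ∀ {x y z} → x ≈ y → ¬ x ≈ z → ¬ y ≈ z
  ≉-transport x≈y x≉z y≈z = x≉z (trans x≈y y≈z)

  ≉-sym : ∀ {x y} → ¬ x ≈ y → ¬ y ≈ x
  ≉-sym x≉y y≈x = x≉y (sym y≈x)

  peel : ∀ {k} (h : V5 F) {v x} {vs : Vec (V5 F) k} → ⟪ h , v ⟫ ≈ x → ¬ x ≈ 0# →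
         All (λ w → ⟪ h , w ⟫ ≈ 0#) vs → Independent vs → Independent (v ∷ vs)
  peel h hv≈x x≉0 = independent-∷ {h = h} (λ hv≈0 → x≉0 (trans (sym hv≈x) hv≈0))

  2≉0 : ¬ 2# F ≈ 0#
  2≉0 2≈0 = 3-nonsquare (1# , trans (*-identityˡ 1#) (trans (sym (+-identityˡ 1#)) (+-congʳ (sym 2≈0))))

  3≉0 : ¬ 3# F ≈ 0#
  3≉0 3≈0 = 3-nonsquare (0# , trans (zeroˡ 0#) (sym 3≈0))

  12≉0 : ¬ 4# F * 3# F ≈ 0#
  12≉0 = ≉0-resp-≈ (2≉0 ⊛ 2≉0) 2*2≈4 ⊛ 3≉0
    where
    2*2≈4 : 2# F * 2# F ≈ 4# F
    2*2≈4 = solve 0 (S.2# S.* S.2# := S.4#) refl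

  -- x² = 3y² with y ≠ 0 would make 3 = (x/y)² a square.
  x²≉3y² : ∀ {x y} → ¬ y ≈ 0# → ¬ x * x - 3# F * (y * y) ≈ 0#
  x²≉3y² {x} {y} y≉0 x²-3y²≈0 with proj₂ fld y y≉0
  ... | z , yz≈1 = 3-nonsquare (x * z , (begin
    x * z * (x * z)                                                ≈⟨ expand x y z ⟩
    (x * x - 3# F * (y * y)) * (z * z) + 3# F * (y * z * (y * z))
      ≈⟨ +-cong (*-congʳ x²-3y²≈0) (*-congˡ (*-cong yz≈1 yz≈1)) ⟩
    0# * (z * z) + 3# F * (1# * 1#)                                ≈⟨ simplify (z * z) ⟩
    3# F                                                           ∎))
    where
    expand : ∀ x y z → x * z * (x * z) ≈ (x * x - 3# F * (y * y)) * (z * z) + 3# F * (y * z * (y * z))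
    expand = solve 3 (λ x y z →
      x S.* z S.* (x S.* z) := (x S.* x S.- S.3# S.* (y S.* y)) S.* (z S.* z) S.+ S.3# S.* (y S.* z S.* (y S.* z))) refl
    simplify : ∀ w → 0# * w + 3# F * (1# * 1#) ≈ 3# F
    simplify = solve 1 (λ w → S.0# S.* w S.+ S.3# S.* (S.1# S.* S.1#) := S.3#) refl

  form₃≈0⇒sum≉0 : ∀ {u₁ u₂ d} → ¬ d ≈ 0# → form₃ u₁ u₂ d ≈ 0# → ¬ u₁ + u₂ ≈ 0#
  form₃≈0⇒sum≉0 {u₁} {u₂} {d} d≉0 form₃≈0 u₁+u₂≈0 = x²≉3y² d≉0 (begin
    u₁ * u₁ - 3# F * (d * d)          ≈⟨ identity u₁ u₂ d ⟨
    form₃ u₁ u₂ d - (u₁ + u₂) * u₂    ≈⟨ +-cong form₃≈0 (-‿cong (trans (*-congʳ u₁+u₂≈0) (zeroˡ u₂))) ⟩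
    0# - 0#                           ≈⟨ -‿inverseʳ 0# ⟩
    0#                                ∎)
    where
    identity : ∀ u₁ u₂ d → form₃ u₁ u₂ d - (u₁ + u₂) * u₂ ≈ u₁ * u₁ - 3# F * (d * d)
    identity = solve 3 (λ u₁ u₂ d → S.form₃ u₁ u₂ d S.- (u₁ S.+ u₂) S.* u₂ := u₁ S.* u₁ S.- S.3# S.* (d S.* d)) refl

  form₃≈0⇒form₂≉0 : ∀ {u₁ u₂ d} → ¬ u₁ - u₂ ≈ 0# → form₃ u₁ u₂ d ≈ 0# → ¬ form₂ u₁ u₂ d ≈ 0#
  form₃≈0⇒form₂≉0 {u₁} {u₂} {d} u₁-u₂≉0 form₃≈0 form₂≈0 = (u₁-u₂≉0 ⊛ u₁-u₂≉0) (begin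
    (u₁ - u₂) * (u₁ - u₂)                        ≈⟨ identity u₁ u₂ d ⟩
    3# F * form₂ u₁ u₂ d - 2# F * form₃ u₁ u₂ d  ≈⟨ +-cong (*-congˡ form₂≈0) (-‿cong (*-congˡ form₃≈0)) ⟩
    3# F * 0# - 2# F * 0#                        ≈⟨ vanish ⟩
    0#                                           ∎)
    where
    identity : ∀ u₁ u₂ d → (u₁ - u₂) * (u₁ - u₂) ≈ 3# F * form₂ u₁ u₂ d - 2# F * form₃ u₁ u₂ d
    identity = solve 3 (λ u₁ u₂ d →
      (u₁ S.- u₂) S.* (u₁ S.- u₂) := S.3# S.* S.form₂ u₁ u₂ d S.- S.2# S.* S.form₃ u₁ u₂ d) refl
    vanish : 3# F * 0# - 2# F * 0# ≈ 0#
    vanish = solve 0 (S.3# S.* S.0# S.- S.2# S.* S.0# := S.0#) refl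

  independent-C : ∀ a → Independent (C a ∷ [])
  independent-C a = peel [1] ([1]-curve a) 1≉0 [] independent-[]

  independent-T : ∀ b → Independent (T b ∷ [])
  independent-T b = peel [x] ([x]-tangent b) 1≉0 [] independent-[]

  independent-I : Independent (I ∷ [])
  independent-I = peel [x⁴] [x⁴]-infinity 1≉0 [] independent-[]

  independent-CC : ∀ a₁ a₂ → ¬ a₁ ≈ a₂ → Independent (C a₁ ∷ C a₂ ∷ [])
  independent-CC a₁ a₂ d₁₂ =
    peel [x- a₂ ] (linear-curve a₂ a₁) (diff d₁₂) (linear-root a₂ ∷ []) (independent-C a₂)

  independent-CT : ∀ a b → Independent (C a ∷ T b ∷ [])
  independent-CT a b = peel [1] ([1]-curve a) 1≉0 ([1]-tangent b ∷ []) (independent-T b)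

  independent-CI : ∀ a → Independent (C a ∷ I ∷ [])
  independent-CI a = peel [1] ([1]-curve a) 1≉0 ([1]-infinity ∷ []) independent-I

  independent-TT : ∀ b₁ b₂ → ¬ b₁ ≈ b₂ → Independent (T b₁ ∷ T b₂ ∷ [])
  independent-TT b₁ b₂ d₁₂ =
    peel ([x- b₂ ] · [x- b₂ ]) (square-tangent b₂ b₁) (2≉0 ⊛ diff d₁₂) (square-critical b₂ ∷ []) (independent-T b₂)

  independent-TI : ∀ b → Independent (T b ∷ I ∷ [])
  independent-TI b = peel [x] ([x]-tangent b) 1≉0 ([x]-infinity ∷ []) independent-I

  independent-CCC : ∀ a₁ a₂ a₃ → ¬ a₁ ≈ a₂ → ¬ a₁ ≈ a₃ → ¬ a₂ ≈ a₃ → Independent (C a₁ ∷ C a₂ ∷ C a₃ ∷ [])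
  independent-CCC a₁ a₂ a₃ d₁₂ d₁₃ d₂₃ =
    peel ([x- a₂ ] · [x- a₃ ]) (quadratic-curve a₂ a₃ a₁) (diff d₁₂ ⊛ diff d₁₃)
      (quadratic-root₁ a₂ a₃ ∷ quadratic-root₂ a₂ a₃ ∷ [])
      (independent-CC a₂ a₃ d₂₃)

  independent-CCI : ∀ a₁ a₂ → ¬ a₁ ≈ a₂ → Independent (C a₁ ∷ C a₂ ∷ I ∷ [])
  independent-CCI a₁ a₂ d₁₂ =
    peel [x- a₂ ] (linear-curve a₂ a₁) (diff d₁₂)
      (linear-root a₂ ∷ linear-infinity a₂ ∷ [])
      (independent-CI a₂)

  independent-CTT : ∀ a b₁ b₂ → ¬ b₁ ≈ b₂ → Independent (C a ∷ T b₁ ∷ T b₂ ∷ [])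
  independent-CTT a b₁ b₂ d₁₂ =
    peel [1] ([1]-curve a) 1≉0 ([1]-tangent b₁ ∷ [1]-tangent b₂ ∷ []) (independent-TT b₁ b₂ d₁₂)

  independent-CTI : ∀ a b → Independent (C a ∷ T b ∷ I ∷ [])
  independent-CTI a b = peel [1] ([1]-curve a) 1≉0 ([1]-tangent b ∷ [1]-infinity ∷ []) (independent-TI b)

  independent-TTT : ∀ b₁ b₂ b₃ → ¬ b₁ ≈ b₂ → ¬ b₁ ≈ b₃ → ¬ b₂ ≈ b₃ → Independent (T b₁ ∷ T b₂ ∷ T b₃ ∷ [])
  independent-TTT b₁ b₂ b₃ d₁₂ d₁₃ d₂₃ =
    peel (criticalCubic b₂ b₃) (criticalCubic-tangent b₂ b₃ b₁) (12≉0 ⊛ (diff d₁₂ ⊛ diff d₁₃))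
      (criticalCubic-critical₁ b₂ b₃ ∷ criticalCubic-critical₂ b₂ b₃ ∷ [])
      (independent-TT b₂ b₃ d₂₃)

  independent-TTI : ∀ b₁ b₂ → ¬ b₁ ≈ b₂ → Independent (T b₁ ∷ T b₂ ∷ I ∷ [])
  independent-TTI b₁ b₂ d₁₂ =
    peel ([x- b₂ ] · [x- b₂ ]) (square-tangent b₂ b₁) (2≉0 ⊛ diff d₁₂)
      (square-critical b₂ ∷ square-infinity b₂ ∷ [])
      (independent-TI b₂)

  -- If the tangent is at a₁ itself, (x - a₂)(x - (2b - a₂)) has its critical point at b, the midpoint
  -- of its roots; otherwise (x - a₂)(x - b)² works.
  independent-CCT : ∀ a₁ a₂ b → ¬ a₁ ≈ a₂ → Independent (C a₁ ∷ C a₂ ∷ T b ∷ [])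
  independent-CCT a₁ a₂ b d₁₂ with a₁ ≟ b
  ... | yes a₁≈b = independent-cong-head (curve-cong a₁≈b)
    (peel ([x- a₂ ] · [x- 2# F * b - a₂ ]) (symmetric-curve a₂ b)
      (diff (≉-transport a₁≈b d₁₂) ⊛ diff (≉-sym (≉-transport a₁≈b d₁₂)))
      (symmetric-root a₂ b ∷ symmetric-critical a₂ b ∷ [])
      (independent-CT a₂ b))
  ... | no a₁≉b =
    peel ([x- a₂ ] · [x- b ] · [x- b ]) (linearSquare-curve a₂ b a₁) (diff d₁₂ ⊛ diff a₁≉b ⊛ diff a₁≉b)
      (linearSquare-root a₂ b ∷ linearSquare-critical a₂ b ∷ [])
      (independent-CT a₂ b)

  independent-CCTI : ∀ a₁ a₂ b → ¬ a₁ ≈ a₂ → Independent (C a₁ ∷ C a₂ ∷ T b ∷ I ∷ [])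
  independent-CCTI a₁ a₂ b d₁₂ with a₁ ≟ b
  ... | yes a₁≈b = independent-cong-head (curve-cong a₁≈b)
    (peel ([x- a₂ ] · [x- 2# F * b - a₂ ]) (symmetric-curve a₂ b)
      (diff (≉-transport a₁≈b d₁₂) ⊛ diff (≉-sym (≉-transport a₁≈b d₁₂)))
      (symmetric-root a₂ b ∷ symmetric-critical a₂ b ∷ symmetric-infinity a₂ b ∷ [])
      (independent-CTI a₂ b))
  ... | no a₁≉b =
    peel ([x- a₂ ] · [x- b ] · [x- b ]) (linearSquare-curve a₂ b a₁) (diff d₁₂ ⊛ diff a₁≉b ⊛ diff a₁≉b)
      (linearSquare-root a₂ b ∷ linearSquare-critical a₂ b ∷ linearSquare-infinity a₂ b ∷ [])
      (independent-CTI a₂ b)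

  independent-CCCC : ∀ a₁ a₂ a₃ a₄ → ¬ a₁ ≈ a₂ → ¬ a₁ ≈ a₃ → ¬ a₁ ≈ a₄ → ¬ a₂ ≈ a₃ → ¬ a₂ ≈ a₄ → ¬ a₃ ≈ a₄ →
                     Independent (C a₁ ∷ C a₂ ∷ C a₃ ∷ C a₄ ∷ [])
  independent-CCCC a₁ a₂ a₃ a₄ d₁₂ d₁₃ d₁₄ d₂₃ d₂₄ d₃₄ =
    peel ([x- a₂ ] · [x- a₃ ] · [x- a₄ ]) (cubic-curve a₂ a₃ a₄ a₁) (diff d₁₂ ⊛ diff d₁₃ ⊛ diff d₁₄)
      (cubic-root₁ a₂ a₃ a₄ ∷ cubic-root₂ a₂ a₃ a₄ ∷ cubic-root₃ a₂ a₃ a₄ ∷ [])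
      (independent-CCC a₂ a₃ a₄ d₂₃ d₂₄ d₃₄)

  independent-CCCT : ∀ a₁ a₂ a₃ b → ¬ a₁ ≈ a₂ → ¬ a₁ ≈ a₃ → ¬ a₂ ≈ a₃ →
                     Independent (C a₁ ∷ C a₂ ∷ C a₃ ∷ T b ∷ [])
  independent-CCCT a₁ a₂ a₃ b d₁₂ d₁₃ d₂₃ with a₁ ≟ b
  ... | yes a₁≈b = independent-cong-head (curve-cong a₁≈b)
    (peel (throughTangent b a₂ a₃) (throughTangent-curve b a₂ a₃) (π≉0 ⊛ π≉0)
      (throughTangent-root₂ b a₂ a₃ ∷ throughTangent-root₃ b a₂ a₃ ∷ throughTangent-critical b a₂ a₃ ∷ [])
      (independent-CCT a₂ a₃ b d₂₃))
    where
    π≉0 : ¬ (a₂ - b) * (a₃ - b) ≈ 0#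
    π≉0 = diff (≉-sym (≉-transport a₁≈b d₁₂)) ⊛ diff (≉-sym (≉-transport a₁≈b d₁₃))
  ... | no a₁≉b =
    peel ([x- b ] · [x- b ] · [x- a₂ ] · [x- a₃ ]) (squareQuadratic-curve b a₂ a₃ a₁)
      (diff a₁≉b ⊛ diff a₁≉b ⊛ diff d₁₂ ⊛ diff d₁₃)
      (squareQuadratic-root₂ b a₂ a₃ ∷ squareQuadratic-root₃ b a₂ a₃ ∷ squareQuadratic-critical b a₂ a₃ ∷ [])
      (independent-CCT a₂ a₃ b d₂₃)

  independent-CCCI : ∀ a₁ a₂ a₃ → ¬ a₁ ≈ a₂ → ¬ a₁ ≈ a₃ → ¬ a₂ ≈ a₃ → Independent (C a₁ ∷ C a₂ ∷ C a₃ ∷ I ∷ [])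
  independent-CCCI a₁ a₂ a₃ d₁₂ d₁₃ d₂₃ =
    peel ([x- a₂ ] · [x- a₃ ]) (quadratic-curve a₂ a₃ a₁) (diff d₁₂ ⊛ diff d₁₃)
      (quadratic-root₁ a₂ a₃ ∷ quadratic-root₂ a₂ a₃ ∷ quadratic-infinity a₂ a₃ ∷ [])
      (independent-CCI a₂ a₃ d₂₃)

  -- The only configuration that needs 3 to be a non-square. Writing u = 2t - b₁ - b₂, the cubic with
  -- critical points b₁, b₂ that vanishes at a₂ takes the value (a₁ - a₂) form₃ at a₁; if form₃ = 0,
  -- then 8((x - b₁)(x - b₂))², shifted to vanish at a₂, takes the value (a₁ - a₂)(u₁ + u₂) form₂ there.
  independent-CCTT : ∀ a₁ a₂ b₁ b₂ → ¬ a₁ ≈ a₂ → ¬ b₁ ≈ b₂ → Independent (C a₁ ∷ C a₂ ∷ T b₁ ∷ T b₂ ∷ [])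
  independent-CCTT a₁ a₂ b₁ b₂ d₁₂ d₃₄ with form₃ (centred b₁ b₂ a₁) (centred b₁ b₂ a₂) (b₁ - b₂) ≟ 0#
  ... | no form₃≉0 =
    peel (criticalCubic b₁ b₂ -valueAt a₂) (criticalCubic-valueAt-curve a₂ b₁ b₂ a₁) (diff d₁₂ ⊛ form₃≉0)
      (valueAt-root (criticalCubic b₁ b₂) a₂
        ∷ trans (valueAt-tangent (criticalCubic b₁ b₂) a₂ b₁) (criticalCubic-critical₁ b₁ b₂)
        ∷ trans (valueAt-tangent (criticalCubic b₁ b₂) a₂ b₂) (criticalCubic-critical₂ b₁ b₂) ∷ [])
      (independent-CTT a₂ b₁ b₂ d₃₄)
  ... | yes form₃≈0 =
    peel (squaredQuadratic b₁ b₂ -valueAt a₂) (squaredQuadratic-valueAt-curve a₂ b₁ b₂ a₁)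
      (diff d₁₂ ⊛ (form₃≈0⇒sum≉0 (diff d₃₄) form₃≈0 ⊛ form₃≈0⇒form₂≉0 u₁-u₂≉0 form₃≈0))
      (valueAt-root (squaredQuadratic b₁ b₂) a₂
        ∷ trans (valueAt-tangent (squaredQuadratic b₁ b₂) a₂ b₁) (squaredQuadratic-critical₁ b₁ b₂)
        ∷ trans (valueAt-tangent (squaredQuadratic b₁ b₂) a₂ b₂) (squaredQuadratic-critical₂ b₁ b₂) ∷ [])
      (independent-CTT a₂ b₁ b₂ d₃₄)
    where
    centred-diff : ∀ b₁ b₂ a₁ a₂ → centred b₁ b₂ a₁ - centred b₁ b₂ a₂ ≈ 2# F * (a₁ - a₂)
    centred-diff = solve 4 (λ b₁ b₂ a₁ a₂ →
      S.centred b₁ b₂ a₁ S.- S.centred b₁ b₂ a₂ := S.2# S.* (a₁ S.- a₂)) refl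
    u₁-u₂≉0 : ¬ centred b₁ b₂ a₁ - centred b₁ b₂ a₂ ≈ 0#
    u₁-u₂≉0 = ≉0-resp-≈ (2≉0 ⊛ diff d₁₂) (sym (centred-diff b₁ b₂ a₁ a₂))

  independent-CTTT : ∀ a b₁ b₂ b₃ → ¬ b₁ ≈ b₂ → ¬ b₁ ≈ b₃ → ¬ b₂ ≈ b₃ →
                     Independent (C a ∷ T b₁ ∷ T b₂ ∷ T b₃ ∷ [])
  independent-CTTT a b₁ b₂ b₃ d₁₂ d₁₃ d₂₃ =
    peel [1] ([1]-curve a) 1≉0
      ([1]-tangent b₁ ∷ [1]-tangent b₂ ∷ [1]-tangent b₃ ∷ [])
      (independent-TTT b₁ b₂ b₃ d₁₂ d₁₃ d₂₃)

  independent-CTTI : ∀ a b₁ b₂ → ¬ b₁ ≈ b₂ → Independent (C a ∷ T b₁ ∷ T b₂ ∷ I ∷ [])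
  independent-CTTI a b₁ b₂ d₁₂ =
    peel [1] ([1]-curve a) 1≉0
      ([1]-tangent b₁ ∷ [1]-tangent b₂ ∷ [1]-infinity ∷ [])
      (independent-TTI b₁ b₂ d₁₂)

  independent-TTTT : ∀ b₁ b₂ b₃ b₄ → ¬ b₁ ≈ b₂ → ¬ b₁ ≈ b₃ → ¬ b₁ ≈ b₄ → ¬ b₂ ≈ b₃ → ¬ b₂ ≈ b₄ → ¬ b₃ ≈ b₄ →
                     Independent (T b₁ ∷ T b₂ ∷ T b₃ ∷ T b₄ ∷ [])
  independent-TTTT b₁ b₂ b₃ b₄ d₁₂ d₁₃ d₁₄ d₂₃ d₂₄ d₃₄ =
    peel (criticalQuartic b₂ b₃ b₄) (criticalQuartic-tangent b₂ b₃ b₄ b₁) (12≉0 ⊛ (diff d₁₂ ⊛ diff d₁₃ ⊛ diff d₁₄))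
      (criticalQuartic-critical₁ b₂ b₃ b₄ ∷ criticalQuartic-critical₂ b₂ b₃ b₄ ∷ criticalQuartic-critical₃ b₂ b₃ b₄ ∷ [])
      (independent-TTT b₂ b₃ b₄ d₂₃ d₂₄ d₃₄)

  independent-TTTI : ∀ b₁ b₂ b₃ → ¬ b₁ ≈ b₂ → ¬ b₁ ≈ b₃ → ¬ b₂ ≈ b₃ → Independent (T b₁ ∷ T b₂ ∷ T b₃ ∷ I ∷ [])
  independent-TTTI b₁ b₂ b₃ d₁₂ d₁₃ d₂₃ =
    peel (criticalCubic b₂ b₃) (criticalCubic-tangent b₂ b₃ b₁) (12≉0 ⊛ (diff d₁₂ ⊛ diff d₁₃))
      (criticalCubic-critical₁ b₂ b₃ ∷ criticalCubic-critical₂ b₂ b₃ ∷ criticalCubic-infinity b₂ b₃ ∷ [])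
      (independent-TTI b₂ b₃ d₂₃)

  data Point : Set c where
    curve tangent : Carrier → Point
    infinity : Point

  ⟦_⟧ : Point → V5 F
  ⟦ curve t ⟧   = C t
  ⟦ tangent t ⟧ = T t
  ⟦ infinity ⟧  = I

  Distinct : Point → Point → Set ℓ
  Distinct (curve s)   (curve t)   = ¬ s ≈ t
  Distinct (tangent s) (tangent t) = ¬ s ≈ t
  Distinct infinity    infinity    = ⊥ₚ
  Distinct _           _           = ⊤ₚ

  -- Sort the four points by kind (curve, tangent, infinity) with adjacent transpositions.
  distinct⇒independent : ∀ p₁ p₂ p₃ p₄ → Distinct p₁ p₂ → Distinct p₁ p₃ → Distinct p₁ p₄ →
                         Distinct p₂ p₃ → Distinct p₂ p₄ → Distinct p₃ p₄ →
                         Independent (⟦ p₁ ⟧ ∷ ⟦ p₂ ⟧ ∷ ⟦ p₃ ⟧ ∷ ⟦ p₄ ⟧ ∷ [])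
  distinct⇒independent (curve x₁) (curve x₂) (curve x₃) (curve x₄) d₁₂ d₁₃ d₁₄ d₂₃ d₂₄ d₃₄ =
    independent-CCCC x₁ x₂ x₃ x₄ d₁₂ d₁₃ d₁₄ d₂₃ d₂₄ d₃₄
  distinct⇒independent (curve x₁) (curve x₂) (curve x₃) (tangent x₄) d₁₂ d₁₃ _ d₂₃ _ _ =
    independent-CCCT x₁ x₂ x₃ x₄ d₁₂ d₁₃ d₂₃
  distinct⇒independent (curve x₁) (curve x₂) (curve x₃) infinity d₁₂ d₁₃ _ d₂₃ _ _ =
    independent-CCCI x₁ x₂ x₃ d₁₂ d₁₃ d₂₃
  distinct⇒independent (curve x₁) (curve x₂) (tangent x₃) (curve x₄) d₁₂ _ d₁₄ _ d₂₄ _ =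
    swap₃₄ (independent-CCCT x₁ x₂ x₄ x₃ d₁₂ d₁₄ d₂₄)
  distinct⇒independent (curve x₁) (curve x₂) (tangent x₃) (tangent x₄) d₁₂ _ _ _ _ d₃₄ =
    independent-CCTT x₁ x₂ x₃ x₄ d₁₂ d₃₄
  distinct⇒independent (curve x₁) (curve x₂) (tangent x₃) infinity d₁₂ _ _ _ _ _ = independent-CCTI x₁ x₂ x₃ d₁₂
  distinct⇒independent (curve x₁) (curve x₂) infinity (curve x₄) d₁₂ _ d₁₄ _ d₂₄ _ =
    swap₃₄ (independent-CCCI x₁ x₂ x₄ d₁₂ d₁₄ d₂₄)
  distinct⇒independent (curve x₁) (curve x₂) infinity (tangent x₄) d₁₂ _ _ _ _ _ =
    swap₃₄ (independent-CCTI x₁ x₂ x₄ d₁₂)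
  distinct⇒independent (curve x₁) (curve x₂) infinity infinity _ _ _ _ _ ()
  distinct⇒independent (curve x₁) (tangent x₂) (curve x₃) (curve x₄) _ d₁₃ d₁₄ _ _ d₃₄ =
    swap₂₃ (swap₃₄ (independent-CCCT x₁ x₃ x₄ x₂ d₁₃ d₁₄ d₃₄))
  distinct⇒independent (curve x₁) (tangent x₂) (curve x₃) (tangent x₄) _ d₁₃ _ _ d₂₄ _ =
    swap₂₃ (independent-CCTT x₁ x₃ x₂ x₄ d₁₃ d₂₄)
  distinct⇒independent (curve x₁) (tangent x₂) (curve x₃) infinity _ d₁₃ _ _ _ _ =
    swap₂₃ (independent-CCTI x₁ x₃ x₂ d₁₃)
  distinct⇒independent (curve x₁) (tangent x₂) (tangent x₃) (curve x₄) _ _ d₁₄ d₂₃ _ _ =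
    swap₃₄ (swap₂₃ (independent-CCTT x₁ x₄ x₂ x₃ d₁₄ d₂₃))
  distinct⇒independent (curve x₁) (tangent x₂) (tangent x₃) (tangent x₄) _ _ _ d₂₃ d₂₄ d₃₄ =
    independent-CTTT x₁ x₂ x₃ x₄ d₂₃ d₂₄ d₃₄
  distinct⇒independent (curve x₁) (tangent x₂) (tangent x₃) infinity _ _ _ d₂₃ _ _ =
    independent-CTTI x₁ x₂ x₃ d₂₃
  distinct⇒independent (curve x₁) (tangent x₂) infinity (curve x₄) _ _ d₁₄ _ _ _ =
    swap₃₄ (swap₂₃ (independent-CCTI x₁ x₄ x₂ d₁₄))
  distinct⇒independent (curve x₁) (tangent x₂) infinity (tangent x₄) _ _ _ _ d₂₄ _ =
    swap₃₄ (independent-CTTI x₁ x₂ x₄ d₂₄)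
  distinct⇒independent (curve x₁) (tangent x₂) infinity infinity _ _ _ _ _ ()
  distinct⇒independent (curve x₁) infinity (curve x₃) (curve x₄) _ d₁₃ d₁₄ _ _ d₃₄ =
    swap₂₃ (swap₃₄ (independent-CCCI x₁ x₃ x₄ d₁₃ d₁₄ d₃₄))
  distinct⇒independent (curve x₁) infinity (curve x₃) (tangent x₄) _ d₁₃ _ _ _ _ =
    swap₂₃ (swap₃₄ (independent-CCTI x₁ x₃ x₄ d₁₃))
  distinct⇒independent (curve x₁) infinity (curve x₃) infinity _ _ _ _ () _
  distinct⇒independent (curve x₁) infinity (tangent x₃) (curve x₄) _ _ d₁₄ _ _ _ =
    swap₂₃ (swap₃₄ (swap₂₃ (independent-CCTI x₁ x₄ x₃ d₁₄)))
  distinct⇒independent (curve x₁) infinity (tangent x₃) (tangent x₄) _ _ _ _ _ d₃₄ =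
    swap₂₃ (swap₃₄ (independent-CTTI x₁ x₃ x₄ d₃₄))
  distinct⇒independent (curve x₁) infinity (tangent x₃) infinity _ _ _ _ () _
  distinct⇒independent (curve x₁) infinity infinity (curve x₄) _ _ _ () _ _
  distinct⇒independent (curve x₁) infinity infinity (tangent x₄) _ _ _ () _ _
  distinct⇒independent (curve x₁) infinity infinity infinity _ _ _ () _ _
  distinct⇒independent (tangent x₁) (curve x₂) (curve x₃) (curve x₄) _ _ _ d₂₃ d₂₄ d₃₄ =
    swap₁₂ (swap₂₃ (swap₃₄ (independent-CCCT x₂ x₃ x₄ x₁ d₂₃ d₂₄ d₃₄)))
  distinct⇒independent (tangent x₁) (curve x₂) (curve x₃) (tangent x₄) _ _ d₁₄ d₂₃ _ _ =
    swap₁₂ (swap₂₃ (independent-CCTT x₂ x₃ x₁ x₄ d₂₃ d₁₄))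
  distinct⇒independent (tangent x₁) (curve x₂) (curve x₃) infinity _ _ _ d₂₃ _ _ =
    swap₁₂ (swap₂₃ (independent-CCTI x₂ x₃ x₁ d₂₃))
  distinct⇒independent (tangent x₁) (curve x₂) (tangent x₃) (curve x₄) _ d₁₃ _ _ d₂₄ _ =
    swap₁₂ (swap₃₄ (swap₂₃ (independent-CCTT x₂ x₄ x₁ x₃ d₂₄ d₁₃)))
  distinct⇒independent (tangent x₁) (curve x₂) (tangent x₃) (tangent x₄) _ d₁₃ d₁₄ _ _ d₃₄ =
    swap₁₂ (independent-CTTT x₂ x₁ x₃ x₄ d₁₃ d₁₄ d₃₄)
  distinct⇒independent (tangent x₁) (curve x₂) (tangent x₃) infinity _ d₁₃ _ _ _ _ =
    swap₁₂ (independent-CTTI x₂ x₁ x₃ d₁₃)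
  distinct⇒independent (tangent x₁) (curve x₂) infinity (curve x₄) _ _ _ _ d₂₄ _ =
    swap₁₂ (swap₃₄ (swap₂₃ (independent-CCTI x₂ x₄ x₁ d₂₄)))
  distinct⇒independent (tangent x₁) (curve x₂) infinity (tangent x₄) _ _ d₁₄ _ _ _ =
    swap₁₂ (swap₃₄ (independent-CTTI x₂ x₁ x₄ d₁₄))
  distinct⇒independent (tangent x₁) (curve x₂) infinity infinity _ _ _ _ _ ()
  distinct⇒independent (tangent x₁) (tangent x₂) (curve x₃) (curve x₄) d₁₂ _ _ _ _ d₃₄ =
    swap₂₃ (swap₃₄ (swap₁₂ (swap₂₃ (independent-CCTT x₃ x₄ x₁ x₂ d₃₄ d₁₂))))
  distinct⇒independent (tangent x₁) (tangent x₂) (curve x₃) (tangent x₄) d₁₂ _ d₁₄ _ d₂₄ _ =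
    swap₂₃ (swap₁₂ (independent-CTTT x₃ x₁ x₂ x₄ d₁₂ d₁₄ d₂₄))
  distinct⇒independent (tangent x₁) (tangent x₂) (curve x₃) infinity d₁₂ _ _ _ _ _ =
    swap₂₃ (swap₁₂ (independent-CTTI x₃ x₁ x₂ d₁₂))
  distinct⇒independent (tangent x₁) (tangent x₂) (tangent x₃) (curve x₄) d₁₂ d₁₃ _ d₂₃ _ _ =
    swap₃₄ (swap₂₃ (swap₁₂ (independent-CTTT x₄ x₁ x₂ x₃ d₁₂ d₁₃ d₂₃)))
  distinct⇒independent (tangent x₁) (tangent x₂) (tangent x₃) (tangent x₄) d₁₂ d₁₃ d₁₄ d₂₃ d₂₄ d₃₄ =
    independent-TTTT x₁ x₂ x₃ x₄ d₁₂ d₁₃ d₁₄ d₂₃ d₂₄ d₃₄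
  distinct⇒independent (tangent x₁) (tangent x₂) (tangent x₃) infinity d₁₂ d₁₃ _ d₂₃ _ _ =
    independent-TTTI x₁ x₂ x₃ d₁₂ d₁₃ d₂₃
  distinct⇒independent (tangent x₁) (tangent x₂) infinity (curve x₄) d₁₂ _ _ _ _ _ =
    swap₃₄ (swap₂₃ (swap₁₂ (independent-CTTI x₄ x₁ x₂ d₁₂)))
  distinct⇒independent (tangent x₁) (tangent x₂) infinity (tangent x₄) d₁₂ _ d₁₄ _ d₂₄ _ =
    swap₃₄ (independent-TTTI x₁ x₂ x₄ d₁₂ d₁₄ d₂₄)
  distinct⇒independent (tangent x₁) (tangent x₂) infinity infinity _ _ _ _ _ ()
  distinct⇒independent (tangent x₁) infinity (curve x₃) (curve x₄) _ _ _ _ _ d₃₄ =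
    swap₂₃ (swap₃₄ (swap₁₂ (swap₂₃ (independent-CCTI x₃ x₄ x₁ d₃₄))))
  distinct⇒independent (tangent x₁) infinity (curve x₃) (tangent x₄) _ _ d₁₄ _ _ _ =
    swap₂₃ (swap₃₄ (swap₁₂ (independent-CTTI x₃ x₁ x₄ d₁₄)))
  distinct⇒independent (tangent x₁) infinity (curve x₃) infinity _ _ _ _ () _
  distinct⇒independent (tangent x₁) infinity (tangent x₃) (curve x₄) _ d₁₃ _ _ _ _ =
    swap₂₃ (swap₃₄ (swap₂₃ (swap₁₂ (independent-CTTI x₄ x₁ x₃ d₁₃))))
  distinct⇒independent (tangent x₁) infinity (tangent x₃) (tangent x₄) _ d₁₃ d₁₄ _ _ d₃₄ =
    swap₂₃ (swap₃₄ (independent-TTTI x₁ x₃ x₄ d₁₃ d₁₄ d₃₄))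
  distinct⇒independent (tangent x₁) infinity (tangent x₃) infinity _ _ _ _ () _
  distinct⇒independent (tangent x₁) infinity infinity (curve x₄) _ _ _ () _ _
  distinct⇒independent (tangent x₁) infinity infinity (tangent x₄) _ _ _ () _ _
  distinct⇒independent (tangent x₁) infinity infinity infinity _ _ _ () _ _
  distinct⇒independent infinity (curve x₂) (curve x₃) (curve x₄) _ _ _ d₂₃ d₂₄ d₃₄ =
    swap₁₂ (swap₂₃ (swap₃₄ (independent-CCCI x₂ x₃ x₄ d₂₃ d₂₄ d₃₄)))
  distinct⇒independent infinity (curve x₂) (curve x₃) (tangent x₄) _ _ _ d₂₃ _ _ =
    swap₁₂ (swap₂₃ (swap₃₄ (independent-CCTI x₂ x₃ x₄ d₂₃)))
  distinct⇒independent infinity (curve x₂) (curve x₃) infinity _ _ () _ _ _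
  distinct⇒independent infinity (curve x₂) (tangent x₃) (curve x₄) _ _ _ _ d₂₄ _ =
    swap₁₂ (swap₂₃ (swap₃₄ (swap₂₃ (independent-CCTI x₂ x₄ x₃ d₂₄))))
  distinct⇒independent infinity (curve x₂) (tangent x₃) (tangent x₄) _ _ _ _ _ d₃₄ =
    swap₁₂ (swap₂₃ (swap₃₄ (independent-CTTI x₂ x₃ x₄ d₃₄)))
  distinct⇒independent infinity (curve x₂) (tangent x₃) infinity _ _ () _ _ _
  distinct⇒independent infinity (curve x₂) infinity (curve x₄) _ () _ _ _ _
  distinct⇒independent infinity (curve x₂) infinity (tangent x₄) _ () _ _ _ _
  distinct⇒independent infinity (curve x₂) infinity infinity _ () _ _ _ _
  distinct⇒independent infinity (tangent x₂) (curve x₃) (curve x₄) _ _ _ _ _ d₃₄ =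
    swap₁₂ (swap₂₃ (swap₃₄ (swap₁₂ (swap₂₃ (independent-CCTI x₃ x₄ x₂ d₃₄)))))
  distinct⇒independent infinity (tangent x₂) (curve x₃) (tangent x₄) _ _ _ _ d₂₄ _ =
    swap₁₂ (swap₂₃ (swap₃₄ (swap₁₂ (independent-CTTI x₃ x₂ x₄ d₂₄))))
  distinct⇒independent infinity (tangent x₂) (curve x₃) infinity _ _ () _ _ _
  distinct⇒independent infinity (tangent x₂) (tangent x₃) (curve x₄) _ _ _ d₂₃ _ _ =
    swap₁₂ (swap₂₃ (swap₃₄ (swap₂₃ (swap₁₂ (independent-CTTI x₄ x₂ x₃ d₂₃)))))
  distinct⇒independent infinity (tangent x₂) (tangent x₃) (tangent x₄) _ _ _ d₂₃ d₂₄ d₃₄ =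
    swap₁₂ (swap₂₃ (swap₃₄ (independent-TTTI x₂ x₃ x₄ d₂₃ d₂₄ d₃₄)))
  distinct⇒independent infinity (tangent x₂) (tangent x₃) infinity _ _ () _ _ _
  distinct⇒independent infinity (tangent x₂) infinity (curve x₄) _ () _ _ _ _
  distinct⇒independent infinity (tangent x₂) infinity (tangent x₄) _ () _ _ _ _
  distinct⇒independent infinity (tangent x₂) infinity infinity _ () _ _ _ _
  distinct⇒independent infinity infinity (curve x₃) (curve x₄) () _ _ _ _ _
  distinct⇒independent infinity infinity (curve x₃) (tangent x₄) () _ _ _ _ _
  distinct⇒independent infinity infinity (curve x₃) infinity () _ _ _ _ _
  distinct⇒independent infinity infinity (tangent x₃) (curve x₄) () _ _ _ _ _
  distinct⇒independent infinity infinity (tangent x₃) (tangent x₄) () _ _ _ _ _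
  distinct⇒independent infinity infinity (tangent x₃) infinity () _ _ _ _ _
  distinct⇒independent infinity infinity infinity (curve x₄) () _ _ _ _ _
  distinct⇒independent infinity infinity infinity (tangent x₄) () _ _ _ _ _
  distinct⇒independent infinity infinity infinity infinity () _ _ _ _ _

  private
    samePoint : ∀ {v v′ u u′ : V5 F} {s s′} → ¬ s ≈ 0# → ¬ s′ ≈ 0# → (∀ i → v i ≈ s * u i) →
                (∀ i → v′ i ≈ s′ * u′ i) → (∀ i → u i ≈ u′ i) → SamePoint F v v′
    samePoint {v} {v′} {u} {u′} {s} {s′} s≉0 s′≉0 v≈su v′≈s′u′ u≈u′ with proj₂ fld s s≉0
    ... | s⁻¹ , ss⁻¹≈1 = s′ * s⁻¹ , s′≉0 ⊛ s⁻¹≉0 , λ i → begin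
      v′ i                      ≈⟨ v′≈s′u′ i ⟩
      s′ * u′ i                 ≈⟨ *-congˡ (sym (u≈u′ i)) ⟩
      s′ * u i                  ≈⟨ *-congˡ (trans (sym (*-identityˡ (u i))) (*-congʳ (sym ss⁻¹≈1))) ⟩
      s′ * (s * s⁻¹ * u i)      ≈⟨ regroup s′ s s⁻¹ (u i) ⟩
      s′ * s⁻¹ * (s * u i)      ≈⟨ *-congˡ (sym (v≈su i)) ⟩
      s′ * s⁻¹ * v i            ∎
      where
      s⁻¹≉0 : ¬ s⁻¹ ≈ 0#
      s⁻¹≉0 s⁻¹≈0 = 1≉0 (trans (sym ss⁻¹≈1) (trans (*-congˡ s⁻¹≈0) (zeroʳ s)))
      regroup : ∀ a b c d → a * (b * c * d) ≈ a * c * (b * d)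
      regroup = solve 4 (λ a b c d → a S.* (b S.* c S.* d) := a S.* c S.* (b S.* d)) refl

  representative : ∀ {v} → InS F v → Σ Point λ p → Σ Carrier λ s → ¬ s ≈ 0# × (∀ i → v i ≈ s * ⟦ p ⟧ i)
  representative (inj₁ (t , s , s≉0 , v≈sC))         = curve t , s , s≉0 , v≈sC
  representative (inj₂ (inj₁ (t , s , s≉0 , v≈sT)))  = tangent t , s , s≉0 , v≈sT
  representative (inj₂ (inj₂ (s , s≉0 , v≈sI)))      = infinity , s , s≉0 , v≈sI

  distinct : ∀ {v v′} p p′ {s s′} → ¬ s ≈ 0# → ¬ s′ ≈ 0# →
             (∀ i → v i ≈ s * ⟦ p ⟧ i) → (∀ i → v′ i ≈ s′ * ⟦ p′ ⟧ i) → ¬ SamePoint F v v′ → Distinct p p′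
  distinct (curve s)   (curve t)   s≉0 s′≉0 v≈ v′≈ v≁v′ s≈t =
    v≁v′ (samePoint s≉0 s′≉0 v≈ v′≈ (curve-cong s≈t))
  distinct (tangent s) (tangent t) s≉0 s′≉0 v≈ v′≈ v≁v′ s≈t =
    v≁v′ (samePoint s≉0 s′≉0 v≈ v′≈ (tangent-cong s≈t))
  distinct infinity    infinity    s≉0 s′≉0 v≈ v′≈ v≁v′ =
    ⊥-elim (v≁v′ (samePoint s≉0 s′≉0 v≈ v′≈ (λ i → refl)))
  distinct (curve _)   (tangent _) _ _ _ _ _ = _
  distinct (curve _)   infinity    _ _ _ _ _ = _
  distinct (tangent _) (curve _)   _ _ _ _ _ = _
  distinct (tangent _) infinity    _ _ _ _ _ = _
  distinct infinity    (curve _)   _ _ _ _ _ = _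
  distinct infinity    (tangent _) _ _ _ _ _ = _

  track : IsTrack F (InS F)
  track v₁ v₂ v₃ v₄ _ _ _ _ v₁∈S v₂∈S v₃∈S v₄∈S v₁≁v₂ v₁≁v₃ v₁≁v₄ v₂≁v₃ v₂≁v₄ v₃≁v₄
        (_ , _ , _ , _ , v₁∈plane , v₂∈plane , v₃∈plane , v₄∈plane)
    with representative v₁∈S | representative v₂∈S | representative v₃∈S | representative v₄∈S
  ... | p₁ , s₁ , s₁≉0 , v₁≈ | p₂ , s₂ , s₂≉0 , v₂≈ | p₃ , s₃ , s₃≉0 , v₃≈ | p₄ , s₄ , s₄≉0 , v₄≈ =
    ¬independent-in-plane (independent-rescale (vec₄ s₁ s₂ s₃ s₄) s≉0 v≈s⟦p⟧ points-independent)
      v₁∈plane v₂∈plane v₃∈plane v₄∈plane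
    where
    points-independent : Independent (⟦ p₁ ⟧ ∷ ⟦ p₂ ⟧ ∷ ⟦ p₃ ⟧ ∷ ⟦ p₄ ⟧ ∷ [])
    points-independent = distinct⇒independent p₁ p₂ p₃ p₄
      (distinct p₁ p₂ s₁≉0 s₂≉0 v₁≈ v₂≈ v₁≁v₂) (distinct p₁ p₃ s₁≉0 s₃≉0 v₁≈ v₃≈ v₁≁v₃)
      (distinct p₁ p₄ s₁≉0 s₄≉0 v₁≈ v₄≈ v₁≁v₄) (distinct p₂ p₃ s₂≉0 s₃≉0 v₂≈ v₃≈ v₂≁v₃)
      (distinct p₂ p₄ s₂≉0 s₄≉0 v₂≈ v₄≈ v₂≁v₄) (distinct p₃ p₄ s₃≉0 s₄≉0 v₃≈ v₄≈ v₃≁v₄)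
    s≉0 : ∀ j → ¬ vec₄ s₁ s₂ s₃ s₄ j ≈ 0#
    s≉0 0F = s₁≉0
    s≉0 1F = s₂≉0
    s≉0 2F = s₃≉0
    s≉0 3F = s₄≉0
    v≈s⟦p⟧ : ∀ j i → lookup (v₁ ∷ v₂ ∷ v₃ ∷ v₄ ∷ []) j i
                   ≈ vec₄ s₁ s₂ s₃ s₄ j * lookup (⟦ p₁ ⟧ ∷ ⟦ p₂ ⟧ ∷ ⟦ p₃ ⟧ ∷ ⟦ p₄ ⟧ ∷ []) j i
    v≈s⟦p⟧ 0F = v₁≈
    v≈s⟦p⟧ 1F = v₂≈
    v≈s⟦p⟧ 2F = v₃≈
    v≈s⟦p⟧ 3F = v₄≈

module Counting {c ℓ} (F : CommutativeRing c ℓ) (fld : IsField F) where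
  open CommutativeRing F
  open FieldProperties F fld
  open NormalCurve F using (C; T; I; curve-cong; tangent-cong)
  open import Data.Fin.Properties using (+↔⊎) renaming (_≟_ to _≟ᶠ_)
  open import Data.Sum.Function.Propositional using (_⊎-↔_)
  open import Function.Bundles using (_↔_; Inverse)
  open import Function.Properties.Inverse using (↔-refl; ↔-trans)
  open import Relation.Binary.Reasoning.Setoid setoid

  ≈-decidable : ∀ {q} → HasOrder F q → ∀ x y → Dec (x ≈ y)
  ≈-decidable (enum , enum-injective , enum-surjective) x y with enum-surjective x | enum-surjective y
  ... | i , enum-i≈x | j , enum-j≈y with i ≟ᶠ j
  ...   | yes ≡.refl = yes (trans (sym enum-i≈x) enum-j≈y)
  ...   | no i≢j     = no λ x≈y → i≢j (enum-injective i j (trans enum-i≈x (trans x≈y (sym enum-j≈y))))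

  hasSize-by-enumeration : ∀ {n} {A : Set} (ι : Fin n ↔ A) (e : A → V5 F) →
    (∀ a → NonZero F (e a) × InS F (e a)) → (∀ a b → SamePoint F (e a) (e b) → a ≡ b) →
    (∀ v → NonZero F v → InS F v → Σ A λ a → SamePoint F (e a) v) → HasSize F (InS F) n
  hasSize-by-enumeration ι e e-valid e-injective e-surjective =
    (λ i → e (to i)) , (λ i → e-valid (to i)) , to-injective , surjective
    where
    open Inverse ι
    to-injective : ∀ i j → SamePoint F (e (to i)) (e (to j)) → i ≡ j
    to-injective i j same = ≡.trans (≡.sym (strictlyInverseʳ i))
                              (≡.trans (≡.cong from (e-injective (to i) (to j) same)) (strictlyInverseʳ j))
    surjective : ∀ v → NonZero F v → InS F v → Σ (Fin _) λ i → SamePoint F (e (to i)) v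
    surjective v v≉0 v∈S with e-surjective v v≉0 v∈S
    ... | a , same = from a , ≡.subst (λ b → SamePoint F (e b) v) (≡.sym (strictlyInverseˡ a)) same

  private
    a*1≈b⇒a≈b : ∀ {a b} → a * 1# ≈ b → a ≈ b
    a*1≈b⇒a≈b a*1≈b = trans (sym (*-identityʳ _)) a*1≈b

    1≉a*0 : ∀ {a} → ¬ 1# ≈ a * 0#
    1≉a*0 1≈a*0 = 1≉0 (trans 1≈a*0 (zeroʳ _))

  curve-scale : ∀ {s t a} → (∀ i → C t i ≈ a * C s i) → s ≈ t
  curve-scale {s} {t} {a} t≈as = begin
    s         ≈⟨ *-identityˡ s ⟨
    1# * s    ≈⟨ *-congʳ (sym (a*1≈b⇒a≈b (sym (t≈as 0F)))) ⟩
    a * s     ≈⟨ t≈as 1F ⟨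
    t         ∎

  tangent-scale : ∀ {s t a} → ¬ 2# F ≈ 0# → (∀ i → T t i ≈ a * T s i) → s ≈ t
  tangent-scale {s} {t} {a} 2≉0 t≈as = *-cancelˡ 2≉0 (begin
    2# F * s          ≈⟨ *-identityˡ _ ⟨
    1# * (2# F * s)   ≈⟨ *-congʳ (sym (a*1≈b⇒a≈b (sym (t≈as 1F)))) ⟩
    a * (2# F * s)    ≈⟨ t≈as 2F ⟨
    2# F * t          ∎)

  size : ∀ q → ¬ 2# F ≈ 0# → HasOrder F q → HasSize F (InS F) (2 ℕ.* q ℕ.+ 1)
  size q 2≉0 order@(enum , enum-injective , enum-surjective) =
    hasSize-by-enumeration ι e e-valid e-injective e-surjective
    where
    -- 2 * q + 1 unfolds to (q + (q + 0)) + 1.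
    order′ : HasOrder F (q ℕ.+ 0)
    order′ = ≡.subst (HasOrder F) (≡.sym (ℕ.+-identityʳ q)) order
    enum′ : Fin (q ℕ.+ 0) → Carrier
    enum′ = proj₁ order′

    Index : Set
    Index = (Fin q ⊎ Fin (q ℕ.+ 0)) ⊎ Fin 1

    ι : Fin (2 ℕ.* q ℕ.+ 1) ↔ Index
    ι = ↔-trans +↔⊎ (+↔⊎ ⊎-↔ ↔-refl)

    e : Index → V5 F
    e (inj₁ (inj₁ i)) = C (enum i)
    e (inj₁ (inj₂ i)) = T (enum′ i)
    e (inj₂ _)        = I

    itself : ∀ (v : V5 F) i → v i ≈ 1# * v i
    itself v i = sym (*-identityˡ (v i))

    e-valid : ∀ a → NonZero F (e a) × InS F (e a)
    e-valid (inj₁ (inj₁ i)) = (λ C≈0 → 1≉0 (C≈0 0F)) , inj₁ (enum i , 1# , 1≉0 , itself _)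
    e-valid (inj₁ (inj₂ i)) = (λ T≈0 → 1≉0 (T≈0 1F)) , inj₂ (inj₁ (enum′ i , 1# , 1≉0 , itself _))
    e-valid (inj₂ _)        = (λ I≈0 → 1≉0 (I≈0 4F)) , inj₂ (inj₂ (1# , 1≉0 , itself _))

    e-injective : ∀ a b → SamePoint F (e a) (e b) → a ≡ b
    e-injective (inj₁ (inj₁ i)) (inj₁ (inj₁ j)) (_ , _ , same) =
      ≡.cong (λ k → inj₁ (inj₁ k)) (enum-injective i j (curve-scale same))
    e-injective (inj₁ (inj₂ i)) (inj₁ (inj₂ j)) (_ , _ , same) =
      ≡.cong (λ k → inj₁ (inj₂ k)) (proj₁ (proj₂ order′) i j (tangent-scale 2≉0 same))
    e-injective (inj₂ 0F)       (inj₂ 0F)       _              = ≡.refl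
    e-injective (inj₁ (inj₁ _)) (inj₁ (inj₂ _)) (_ , a≉0 , same) = ⊥-elim (a≉0 (a*1≈b⇒a≈b (sym (same 0F))))
    e-injective (inj₁ (inj₁ _)) (inj₂ _)        (_ , a≉0 , same) = ⊥-elim (a≉0 (a*1≈b⇒a≈b (sym (same 0F))))
    e-injective (inj₁ (inj₂ _)) (inj₂ _)        (_ , a≉0 , same) = ⊥-elim (a≉0 (a*1≈b⇒a≈b (sym (same 1F))))
    e-injective (inj₁ (inj₂ _)) (inj₁ (inj₁ _)) (_ , _ , same)   = ⊥-elim (1≉a*0 (same 0F))
    e-injective (inj₂ _)        (inj₁ (inj₁ _)) (_ , _ , same)   = ⊥-elim (1≉a*0 (same 0F))
    e-injective (inj₂ _)        (inj₁ (inj₂ _)) (_ , _ , same)   = ⊥-elim (1≉a*0 (same 1F))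

    e-surjective : ∀ v → NonZero F v → InS F v → Σ Index λ a → SamePoint F (e a) v
    e-surjective v _ (inj₁ (t , a , a≉0 , v≈aC)) with enum-surjective t
    ... | i , enum-i≈t = inj₁ (inj₁ i) , a , a≉0 , λ k → trans (v≈aC k) (*-congˡ (curve-cong (sym enum-i≈t) k))
    e-surjective v _ (inj₂ (inj₁ (t , a , a≉0 , v≈aT))) with proj₂ (proj₂ order′) t
    ... | i , enum′-i≈t = inj₁ (inj₂ i) , a , a≉0 , λ k → trans (v≈aT k) (*-congˡ (tangent-cong (sym enum′-i≈t) k))
    e-surjective v _ (inj₂ (inj₂ same)) = inj₂ 0F , same

open import Data.Nat.Base using (_+_; _*_)

theorem2p4 : {c ℓ : Level} (F : CommutativeRing c ℓ) (q : ℕ) →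
    IsField F → IsPrimePower q → HasOrder F q → ¬ IsSquare F (3# F) →
    IsTrack F (InS F) × HasSize F (InS F) (2 * q + 1)
theorem2p4 F q isField _ order 3-nonsquare = track , size q 2≉0 order
  where
  open Counting F isField using (≈-decidable; size)
  open Track F isField (≈-decidable order) 3-nonsquare using (track; 2≉0)
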